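{- Let $\mathcal{C}$ be a category, let $\mathcal{D}$ be a traced symmetric monoidal category, and let $F:\mathcal{C}\rightarrow\mathcal{D}$ be a functor. Let $N:\mathcal{D}\rightarrow\mathbf{Int}\,\mathcal{D}$ be the canonical embedding of $\mathcal{D}$ into the compact closed category $\mathbf{Int}\,\mathcal{D}$. Then the composite functor $N\circ F:\mathcal{C}\rightarrow\mathbf{Int}\,\mathcal{D}$ has a right adjoint if and only if, for every object $D$ of $\mathcal{D}$, the functor $F(-)\otimes D:\mathcal{C}\rightarrow\mathcal{D}$ has a right adjoint.
   Context: A trace on a symmetric monoidal category $\mathcal{D}$ (with tensor $\otimes$, unit $I$) is a family of maps $\mathrm{Tr}^X_{A,B}:\mathcal{D}(A\otimes X,B\otimes X)\rightarrow\mathcal{D}(A,B)$ satisfying the standard axioms of Joyal–Street–Verity (naturality in $A,B$, dinaturality in $X$, vanishing, superposing, yanking); a traced symmetric monoidal category is a symmetric monoidal category equipped with a trace. The Int-construction: $\mathbf{Int}\,\mathcal{D}$ has as objects pairs $(X,U)$ of objects of $\mathcal{D}$; a morphism $(X,U)\rightarrow(Y,V)$ is a morphism $X\otimes V\rightarrow Y\otimes U$ in $\mathcal{D}$; composition of $f:(X,U)\rightarrow(Y,V)$ and $g:(Y,V)\rightarrow(Z,W)$ is obtained by tracing out $V$ from the evident composite $X\otimes W\otimes V\rightarrow Z\otimes U\otimes V$ built from $f$, $g$ and symmetries; the tensor is $(X_1,U_1)\otimes(X_2,U_2)=(X_1\otimes X_2,U_2\otimes U_1)$ with unit $(I,I)$,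 and the dual of $(X,U)$ is $(U,X)$, making $\mathbf{Int}\,\mathcal{D}$ compact closed. The canonical embedding $N:\mathcal{D}\rightarrow\mathbf{Int}\,\mathcal{D}$ sends an object $X$ to $(X,I)$ and a morphism $f:X\rightarrow Y$ to the corresponding morphism $X\otimes I\rightarrow Y\otimes I$ (via unit isomorphisms); it is a full and faithful strong symmetric monoidal functor. In particular $\mathbf{Int}\,\mathcal{D}((X,I),(Y,D))=\mathcal{D}(X\otimes D,Y\otimes I)$. -}

module Defs where

open import Level using (Level; _⊔_) renaming (suc to lsuc)
open import Relation.Binary using (Rel; IsEquivalence)
open import Data.Product using (_×_; _,_; proj₁; proj₂)

-- Used so that Int D can be described by its operations
-- without having to prove its category laws in this file.

record RawCat (o ℓ e : Level) : Set (lsuc (o ⊔ ℓ ⊔ e)) where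
  infixr 9 _∘_
  infix  4 _≈_
  infix  4 _⇒_
  field
    Obj : Set o
    _⇒_ : Obj → Obj → Set ℓ
    _≈_ : ∀ {A B} → Rel (A ⇒ B) e
    id  : ∀ {A} → A ⇒ A
    _∘_ : ∀ {A B C} → B ⇒ C → A ⇒ B → A ⇒ C

record Category (o ℓ e : Level) : Set (lsuc (o ⊔ ℓ ⊔ e)) where
  field
    raw : RawCat o ℓ e
  open RawCat raw public
  field
    equiv     : ∀ {A B} → IsEquivalence (_≈_ {A} {B})
    assoc     : ∀ {A B C D} {f : A ⇒ B} {g : B ⇒ C} {h : C ⇒ D} →
                (h ∘ g) ∘ f ≈ h ∘ (g ∘ f)
    identityˡ : ∀ {A B} {f : A ⇒ B} → id ∘ f ≈ f
    identityʳ : ∀ {A B} {f : A ⇒ B} → f ∘ id ≈ f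
    ∘-resp-≈  : ∀ {A B C} {f h : B ⇒ C} {g i : A ⇒ B} →
                f ≈ h → g ≈ i → f ∘ g ≈ h ∘ i

record RawFunctor {o ℓ e o′ ℓ′ e′} (A : RawCat o ℓ e) (B : RawCat o′ ℓ′ e′)
       : Set (o ⊔ ℓ ⊔ o′ ⊔ ℓ′) where
  private
    module A = RawCat A
    module B = RawCat B
  field
    F₀ : A.Obj → B.Obj
    F₁ : ∀ {X Y} → X A.⇒ Y → F₀ X B.⇒ F₀ Y

record Functor {o ℓ e o′ ℓ′ e′} (C : Category o ℓ e) (D : Category o′ ℓ′ e′)
       : Set (o ⊔ ℓ ⊔ e ⊔ o′ ⊔ ℓ′ ⊔ e′) where
  private
    module C = Category C
    module D = Category D
  field
    F₀           : C.Obj → D.Obj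
    F₁           : ∀ {X Y} → X C.⇒ Y → F₀ X D.⇒ F₀ Y
    identity     : ∀ {X} → F₁ (C.id {X}) D.≈ D.id
    homomorphism : ∀ {X Y Z} {f : X C.⇒ Y} {g : Y C.⇒ Z} →
                   F₁ (g C.∘ f) D.≈ F₁ g D.∘ F₁ f
    F-resp-≈     : ∀ {X Y} {f g : X C.⇒ Y} → f C.≈ g → F₁ f D.≈ F₁ g

record RightAdjoint {o ℓ e o′ ℓ′ e′} {A : RawCat o ℓ e} {B : RawCat o′ ℓ′ e′}
       (L : RawFunctor A B) : Set (o ⊔ ℓ ⊔ e ⊔ o′ ⊔ ℓ′ ⊔ e′) where
  private
    module A = RawCat A
    module B = RawCat B
    module L = RawFunctor L
  field
    R : RawFunctor B A
  module R = RawFunctor R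
  field
    R-identity     : ∀ {b} → R.F₁ (B.id {b}) A.≈ A.id
    R-homomorphism : ∀ {x y z} {f : x B.⇒ y} {g : y B.⇒ z} →
                     R.F₁ (g B.∘ f) A.≈ R.F₁ g A.∘ R.F₁ f
    R-resp-≈       : ∀ {x y} {f g : x B.⇒ y} → f B.≈ g → R.F₁ f A.≈ R.F₁ g
    φ       : ∀ {a b} → L.F₀ a B.⇒ b → a A.⇒ R.F₀ b
    ψ       : ∀ {a b} → a A.⇒ R.F₀ b → L.F₀ a B.⇒ b
    φ-resp  : ∀ {a b} {k k′ : L.F₀ a B.⇒ b} → k B.≈ k′ → φ k A.≈ φ k′
    ψ-resp  : ∀ {a b} {h h′ : a A.⇒ R.F₀ b} → h A.≈ h′ → ψ h B.≈ ψ h′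
    φψ      : ∀ {a b} (h : a A.⇒ R.F₀ b) → φ (ψ h) A.≈ h
    ψφ      : ∀ {a b} (k : L.F₀ a B.⇒ b) → ψ (φ k) B.≈ k
    natural : ∀ {a a′ b b′} (f : a′ A.⇒ a) (k : L.F₀ a B.⇒ b) (g : b B.⇒ b′) →
              φ (g B.∘ (k B.∘ L.F₁ f)) A.≈ R.F₁ g A.∘ (φ k A.∘ f)

HasRightAdjoint : ∀ {o ℓ e o′ ℓ′ e′} {A : RawCat o ℓ e} {B : RawCat o′ ℓ′ e′} →
                  RawFunctor A B → Set (o ⊔ ℓ ⊔ e ⊔ o′ ⊔ ℓ′ ⊔ e′)
HasRightAdjoint L = RightAdjoint L

record SymmetricMonoidal {o ℓ e} (C : Category o ℓ e) : Set (o ⊔ ℓ ⊔ e) where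
  open Category C
  infixr 10 _⊗₀_ _⊗₁_
  field
    _⊗₀_ : Obj → Obj → Obj
    _⊗₁_ : ∀ {A B C D} → A ⇒ B → C ⇒ D → A ⊗₀ C ⇒ B ⊗₀ D
    unit : Obj
    ⊗-identity     : ∀ {A B} → id {A} ⊗₁ id {B} ≈ id
    ⊗-homomorphism : ∀ {A₁ B₁ C₁ A₂ B₂ C₂}
                     {f₁ : A₁ ⇒ B₁} {g₁ : B₁ ⇒ C₁} {f₂ : A₂ ⇒ B₂} {g₂ : B₂ ⇒ C₂} →
                     (g₁ ∘ f₁) ⊗₁ (g₂ ∘ f₂) ≈ (g₁ ⊗₁ g₂) ∘ (f₁ ⊗₁ f₂)
    ⊗-resp-≈       : ∀ {A B C D} {f f′ : A ⇒ B} {g g′ : C ⇒ D} →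
                     f ≈ f′ → g ≈ g′ → f ⊗₁ g ≈ f′ ⊗₁ g′
    α⇒ : ∀ {A B C} → (A ⊗₀ B) ⊗₀ C ⇒ A ⊗₀ (B ⊗₀ C)
    α⇐ : ∀ {A B C} → A ⊗₀ (B ⊗₀ C) ⇒ (A ⊗₀ B) ⊗₀ C
    λ⇒ : ∀ {A} → unit ⊗₀ A ⇒ A
    λ⇐ : ∀ {A} → A ⇒ unit ⊗₀ A
    ρ⇒ : ∀ {A} → A ⊗₀ unit ⇒ A
    ρ⇐ : ∀ {A} → A ⇒ A ⊗₀ unit
    σ  : ∀ {A B} → A ⊗₀ B ⇒ B ⊗₀ A
    α-isoˡ : ∀ {A B C} → α⇐ ∘ α⇒ ≈ id {(A ⊗₀ B) ⊗₀ C}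
    α-isoʳ : ∀ {A B C} → α⇒ ∘ α⇐ ≈ id {A ⊗₀ (B ⊗₀ C)}
    λ-isoˡ : ∀ {A} → λ⇐ ∘ λ⇒ ≈ id {unit ⊗₀ A}
    λ-isoʳ : ∀ {A} → λ⇒ ∘ λ⇐ ≈ id {A}
    ρ-isoˡ : ∀ {A} → ρ⇐ ∘ ρ⇒ ≈ id {A ⊗₀ unit}
    ρ-isoʳ : ∀ {A} → ρ⇒ ∘ ρ⇐ ≈ id {A}
    α-natural : ∀ {A A′ B B′ C C′} {f : A ⇒ A′} {g : B ⇒ B′} {h : C ⇒ C′} →
                α⇒ ∘ ((f ⊗₁ g) ⊗₁ h) ≈ (f ⊗₁ (g ⊗₁ h)) ∘ α⇒
    λ-natural : ∀ {A B} {f : A ⇒ B} → λ⇒ ∘ (id ⊗₁ f) ≈ f ∘ λ⇒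
    ρ-natural : ∀ {A B} {f : A ⇒ B} → ρ⇒ ∘ (f ⊗₁ id) ≈ f ∘ ρ⇒
    σ-natural : ∀ {A A′ B B′} {f : A ⇒ A′} {g : B ⇒ B′} →
                σ ∘ (f ⊗₁ g) ≈ (g ⊗₁ f) ∘ σ
    pentagon  : ∀ {A B C D} →
                (id {A} ⊗₁ α⇒ {B} {C} {D}) ∘ (α⇒ {A} {B ⊗₀ C} {D} ∘ (α⇒ {A} {B} {C} ⊗₁ id {D}))
                ≈ α⇒ {A} {B} {C ⊗₀ D} ∘ α⇒ {A ⊗₀ B} {C} {D}
    triangle  : ∀ {A B} → (id {A} ⊗₁ λ⇒ {B}) ∘ α⇒ ≈ ρ⇒ {A} ⊗₁ id {B}
    σ-involutive : ∀ {A B} → σ {B} {A} ∘ σ {A} {B} ≈ id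
    hexagon   : ∀ {A B C} →
                α⇒ {B} {C} {A} ∘ (σ {A} {B ⊗₀ C} ∘ α⇒ {A} {B} {C})
                ≈ (id {B} ⊗₁ σ {A} {C}) ∘ (α⇒ {B} {A} {C} ∘ (σ {A} {B} ⊗₁ id {C}))

record Trace {o ℓ e} (C : Category o ℓ e) (S : SymmetricMonoidal C)
       : Set (o ⊔ ℓ ⊔ e) where
  open Category C
  open SymmetricMonoidal S
  field
    Tr : ∀ {A B X} → A ⊗₀ X ⇒ B ⊗₀ X → A ⇒ B
    Tr-resp-≈   : ∀ {A B X} {f g : A ⊗₀ X ⇒ B ⊗₀ X} → f ≈ g → Tr f ≈ Tr g
    tightening  : ∀ {A A′ B B′ X} {f : A ⊗₀ X ⇒ B ⊗₀ X} {g : A′ ⇒ A} {h : B ⇒ B′} →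
                  Tr ((h ⊗₁ id {X}) ∘ (f ∘ (g ⊗₁ id {X}))) ≈ h ∘ (Tr f ∘ g)
    sliding     : ∀ {A B X X′} {f : A ⊗₀ X ⇒ B ⊗₀ X′} {g : X′ ⇒ X} →
                  Tr ((id {B} ⊗₁ g) ∘ f) ≈ Tr (f ∘ (id {A} ⊗₁ g))
    vanishing₁  : ∀ {A B} {f : A ⊗₀ unit ⇒ B ⊗₀ unit} →
                  Tr f ≈ ρ⇒ ∘ (f ∘ ρ⇐)
    vanishing₂  : ∀ {A B X Y} {f : A ⊗₀ (X ⊗₀ Y) ⇒ B ⊗₀ (X ⊗₀ Y)} →
                  Tr {X = X ⊗₀ Y} f ≈ Tr {X = X} (Tr {X = Y} (α⇐ ∘ (f ∘ α⇒)))
    superposing : ∀ {A B C D X} {f : A ⊗₀ X ⇒ B ⊗₀ X} {g : C ⇒ D} →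
                  Tr {X = X} (α⇐ {D} {B} {X} ∘ ((g ⊗₁ f) ∘ α⇒ {C} {A} {X})) ≈ g ⊗₁ Tr f
    yanking     : ∀ {X} → Tr (σ {X} {X}) ≈ id

module IntConstruction {o ℓ e} (D : Category o ℓ e) (S : SymmetricMonoidal D)
                       (T : Trace D S) where
  open Category D
  open SymmetricMonoidal S
  open Trace T

  IntObj : Set o
  IntObj = Obj × Obj

  IntHom : IntObj → IntObj → Set ℓ
  IntHom (X , U) (Y , V) = X ⊗₀ V ⇒ Y ⊗₀ U

  -- composition of f : (X,U) → (Y,V) and g : (Y,V) → (Z,W): trace out V from
  -- (X⊗W)⊗V → X⊗(V⊗W) →(f⊗W) (Y⊗U)⊗W → (Y⊗W)⊗U →(g⊗U) (Z⊗V)⊗U → (Z⊗U)⊗V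
  IntCompose : ∀ {A B C} → IntHom B C → IntHom A B → IntHom A C
  IntCompose {X , U} {Y , V} {Z , W} g f =
    Tr {X = V}
      (α⇐ ∘ ((id {Z} ⊗₁ σ {V} {U}) ∘ (α⇒ ∘ ((g ⊗₁ id {U}) ∘ (α⇐ ∘ ((id {Y} ⊗₁ σ {U} {W})
        ∘ (α⇒ ∘ ((f ⊗₁ id {W}) ∘ (α⇐ ∘ ((id {X} ⊗₁ σ {W} {V}) ∘ α⇒))))))))))

  IntD : RawCat o ℓ e
  IntD = record
    { Obj = IntObj
    ; _⇒_ = IntHom
    ; _≈_ = _≈_
    ; id  = id
    ; _∘_ = IntCompose
    }

  N : RawFunctor raw IntD
  N = record
    { F₀ = λ X → (X , unit)
    ; F₁ = λ f → ρ⇐ ∘ (f ∘ ρ⇒)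
    }

module _ {o₁ ℓ₁ e₁ o₂ ℓ₂ e₂} {C : Category o₁ ℓ₁ e₁} {D : Category o₂ ℓ₂ e₂}
         (S : SymmetricMonoidal D) (T : Trace D S) (F : Functor C D) where
  private
    module C = Category C
    module D = Category D
    module S = SymmetricMonoidal S
    module F = Functor F
    module I = IntConstruction D S T
    module N = RawFunctor I.N

  N∘F : RawFunctor (Category.raw C) I.IntD
  N∘F = record
    { F₀ = λ c → N.F₀ (F.F₀ c)
    ; F₁ = λ f → N.F₁ (F.F₁ f)
    }

  F-⊗_ : D.Obj → RawFunctor (Category.raw C) (Category.raw D)
  F-⊗ d = record
    { F₀ = λ c → F.F₀ c S.⊗₀ d
    ; F₁ = λ f → F.F₁ f S.⊗₁ D.id {d}
    }

module Submission where

-- Int 𝒟 ((F a , I) , (b , d)) = 𝒟 (F a ⊗ d , b ⊗ I) ≅ 𝒟 (F a ⊗ d , b), naturally in a.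
-- Hence a right adjoint R of N ∘ F yields, for each d, right adjoints b ↦ R (b , d) of
-- F (-) ⊗ d (a hom-bijection natural in a alone already determines an adjoint), and
-- conversely right adjoints R_d of the F (-) ⊗ d assemble into (b , d) ↦ R_d b.  The
-- substance is functoriality of the assembled map: an Int-morphism g : (b , d) → (b′ , d′)
-- acts on 𝒟 (A ⊗ d , b) by m ↦ Tr_d (g ∘ (m ⊗ d′) ∘ swap), and this action respects
-- Int-composition because the two nested traces it produces can be interchanged
-- (vanishing and sliding), after which the remaining swaps agree by Yang–Baxter.

open import Level using (_⊔_)
open import Defs
open import Function.Bundles using (_⇔_; mk⇔)
open import Relation.Binary using (Setoid; IsEquivalence)
open import Data.Product using (_,_)
import Relation.Binary.Reasoning.Setoid as SetoidR

module HomReasoning {o ℓ e} (𝒞 : Category o ℓ e) where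
  open Category 𝒞 public

  hom : Obj → Obj → Setoid ℓ e
  hom A B = record { Carrier = A ⇒ B ; _≈_ = _≈_ ; isEquivalence = equiv }

  module HR {A B : Obj} = SetoidR (hom A B)
  open HR public

  ≈refl : ∀ {A B} {f : A ⇒ B} → f ≈ f
  ≈refl = IsEquivalence.refl equiv
  ≈sym : ∀ {A B} {f g : A ⇒ B} → f ≈ g → g ≈ f
  ≈sym = IsEquivalence.sym equiv
  ≈trans : ∀ {A B} {f g h : A ⇒ B} → f ≈ g → g ≈ h → f ≈ h
  ≈trans = IsEquivalence.trans equiv

  infixr 4 _⟩∘⟨_ refl⟩∘⟨_
  infixl 5 _⟩∘⟨refl
  _⟩∘⟨_ : ∀ {A B C} {f h : B ⇒ C} {g i : A ⇒ B} → f ≈ h → g ≈ i → f ∘ g ≈ h ∘ i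
  _⟩∘⟨_ = ∘-resp-≈
  refl⟩∘⟨_ : ∀ {A B C} {f : B ⇒ C} {g i : A ⇒ B} → g ≈ i → f ∘ g ≈ f ∘ i
  refl⟩∘⟨_ p = ∘-resp-≈ ≈refl p
  _⟩∘⟨refl : ∀ {A B C} {f h : B ⇒ C} {g : A ⇒ B} → f ≈ h → f ∘ g ≈ h ∘ g
  _⟩∘⟨refl p = ∘-resp-≈ p ≈refl

  sym-assoc : ∀ {A B C D} {f : A ⇒ B} {g : B ⇒ C} {h : C ⇒ D} →
              h ∘ (g ∘ f) ≈ (h ∘ g) ∘ f
  sym-assoc = ≈sym assoc

  module _ {A B C : Obj} {a : B ⇒ C} {b : A ⇒ B} {c : A ⇒ C} (p : a ∘ b ≈ c) where
    pullˡ : ∀ {Z} {f : Z ⇒ A} → a ∘ (b ∘ f) ≈ c ∘ f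
    pullˡ = ≈trans sym-assoc (p ⟩∘⟨refl)
    pullʳ : ∀ {Z} {f : C ⇒ Z} → (f ∘ a) ∘ b ≈ f ∘ c
    pullʳ = ≈trans assoc (refl⟩∘⟨ p)

  module _ {A B : Obj} {a : B ⇒ A} {b : A ⇒ B} (p : a ∘ b ≈ id) where
    cancelˡ : ∀ {Z} {f : Z ⇒ A} → a ∘ (b ∘ f) ≈ f
    cancelˡ = ≈trans (pullˡ p) identityˡ
    cancelʳ : ∀ {Z} {f : A ⇒ Z} → (f ∘ a) ∘ b ≈ f
    cancelʳ = ≈trans (pullʳ p) identityʳ
    insertˡ : ∀ {Z} {f : Z ⇒ A} → f ≈ a ∘ (b ∘ f)
    insertˡ = ≈sym cancelˡ
    insertʳ : ∀ {Z} {f : A ⇒ Z} → f ≈ (f ∘ a) ∘ b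
    insertʳ = ≈sym cancelʳ

  inv-unique : ∀ {A B} {L R : A ⇒ B} {L′ R′ : B ⇒ A} →
               L ≈ R → L′ ∘ L ≈ id → R ∘ R′ ≈ id → L′ ≈ R′
  inv-unique {L = L} {R} {L′} {R′} p q r = begin
    L′ ≈⟨ insertʳ r ⟩
    (L′ ∘ R) ∘ R′ ≈⟨ (refl⟩∘⟨ ≈sym p) ⟩∘⟨refl ⟩
    (L′ ∘ L) ∘ R′ ≈⟨ q ⟩∘⟨refl ⟩
    id ∘ R′ ≈⟨ identityˡ ⟩
    R′ ∎

  switch-fromˡ : ∀ {A B C} {a : B ⇒ C} {a′ : C ⇒ B} {x : A ⇒ B} {y : A ⇒ C} →
                 a′ ∘ a ≈ id → a ∘ x ≈ y → x ≈ a′ ∘ y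
  switch-fromˡ {a = a} {a′} {x} {y} p q = ≈trans (insertˡ p) (refl⟩∘⟨ q)

  switch-fromʳ : ∀ {A B C} {a : A ⇒ B} {a′ : B ⇒ A} {x : B ⇒ C} {y : A ⇒ C} →
                 a ∘ a′ ≈ id → x ∘ a ≈ y → x ≈ y ∘ a′
  switch-fromʳ p q = ≈trans (insertʳ p) (q ⟩∘⟨refl)

  cancel-isoˡ : ∀ {A B C} {a : B ⇒ C} {a′ : C ⇒ B} {x y : A ⇒ B} →
                a′ ∘ a ≈ id → a ∘ x ≈ a ∘ y → x ≈ y
  cancel-isoˡ p q = ≈trans (switch-fromˡ p q) (cancelˡ p)

  cancel-isoʳ : ∀ {A B C} {a : A ⇒ B} {a′ : B ⇒ A} {x y : B ⇒ C} →
                a ∘ a′ ≈ id → x ∘ a ≈ y ∘ a → x ≈ y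
  cancel-isoʳ p q = ≈trans (switch-fromʳ p q) (cancelʳ p)

  comp-iso : ∀ {A B C} {a : B ⇒ C} {a′ : C ⇒ B} {b : A ⇒ B} {b′ : B ⇒ A} →
             a′ ∘ a ≈ id → b′ ∘ b ≈ id → (b′ ∘ a′) ∘ (a ∘ b) ≈ id
  comp-iso p q = ≈trans (pullʳ (cancelˡ p)) q

  comp3-iso : ∀ {A B C D} {x₁ : B ⇒ A} {x₂ : C ⇒ B} {x₃ : D ⇒ C}
              {y₁ : A ⇒ B} {y₂ : B ⇒ C} {y₃ : C ⇒ D} →
              x₃ ∘ y₃ ≈ id → x₂ ∘ y₂ ≈ id → x₁ ∘ y₁ ≈ id →
              (x₁ ∘ (x₂ ∘ x₃)) ∘ (y₃ ∘ (y₂ ∘ y₁)) ≈ id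
  comp3-iso p q r = ≈trans assoc (≈trans (refl⟩∘⟨ ≈trans assoc (refl⟩∘⟨ cancelˡ p))
                      (≈trans (refl⟩∘⟨ cancelˡ q) r))

module MonoidalProperties {o ℓ e} {𝒞 : Category o ℓ e} (S : SymmetricMonoidal 𝒞) where
  open HomReasoning 𝒞 public
  open SymmetricMonoidal S public

  infixr 6 _⟩⊗⟨_
  _⟩⊗⟨_ : ∀ {A B C D} {f f′ : A ⇒ B} {g g′ : C ⇒ D} → f ≈ f′ → g ≈ g′ → f ⊗₁ g ≈ f′ ⊗₁ g′
  _⟩⊗⟨_ = ⊗-resp-≈

  ∘⊗id : ∀ {A B C X} {f : A ⇒ B} {g : B ⇒ C} → (g ∘ f) ⊗₁ id {X} ≈ (g ⊗₁ id) ∘ (f ⊗₁ id)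
  ∘⊗id = ≈trans (≈refl ⟩⊗⟨ ≈sym identityˡ) ⊗-homomorphism

  id⊗∘ : ∀ {A B C X} {f : A ⇒ B} {g : B ⇒ C} → id {X} ⊗₁ (g ∘ f) ≈ (id ⊗₁ g) ∘ (id ⊗₁ f)
  id⊗∘ = ≈trans (≈sym identityˡ ⟩⊗⟨ ≈refl) ⊗-homomorphism

  ⊗id-iso : ∀ {A B X} {a : A ⇒ B} {a′ : B ⇒ A} → a′ ∘ a ≈ id → (a′ ⊗₁ id {X}) ∘ (a ⊗₁ id) ≈ id
  ⊗id-iso p = ≈trans (≈sym ∘⊗id) (≈trans (p ⟩⊗⟨ ≈refl) ⊗-identity)

  id⊗-iso : ∀ {A B X} {a : A ⇒ B} {a′ : B ⇒ A} → a′ ∘ a ≈ id → (id {X} ⊗₁ a′) ∘ (id ⊗₁ a) ≈ id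
  id⊗-iso p = ≈trans (≈sym id⊗∘) (≈trans (≈refl ⟩⊗⟨ p) ⊗-identity)

  α⇐-natural : ∀ {A A′ B B′ C C′} {f : A ⇒ A′} {g : B ⇒ B′} {h : C ⇒ C′} →
               α⇐ ∘ (f ⊗₁ (g ⊗₁ h)) ≈ ((f ⊗₁ g) ⊗₁ h) ∘ α⇐
  α⇐-natural = begin
    α⇐ ∘ (_ ⊗₁ (_ ⊗₁ _)) ≈⟨ refl⟩∘⟨ insertʳ α-isoʳ ⟩
    α⇐ ∘ (((_ ⊗₁ (_ ⊗₁ _)) ∘ α⇒) ∘ α⇐) ≈⟨ refl⟩∘⟨ (≈sym α-natural ⟩∘⟨refl) ⟩
    α⇐ ∘ ((α⇒ ∘ ((_ ⊗₁ _) ⊗₁ _)) ∘ α⇐) ≈⟨ refl⟩∘⟨ assoc ⟩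
    α⇐ ∘ (α⇒ ∘ (((_ ⊗₁ _) ⊗₁ _) ∘ α⇐)) ≈⟨ cancelˡ α-isoˡ ⟩
    ((_ ⊗₁ _) ⊗₁ _) ∘ α⇐ ∎

  cancel-⊗unitʳ : ∀ {A B} {f g : A ⇒ B} → f ⊗₁ id {unit} ≈ g ⊗₁ id → f ≈ g
  cancel-⊗unitʳ {f = f} {g} p = begin
    f ≈⟨ insertʳ ρ-isoʳ ⟩
    (f ∘ ρ⇒) ∘ ρ⇐ ≈⟨ ≈sym ρ-natural ⟩∘⟨refl ⟩
    (ρ⇒ ∘ (f ⊗₁ id)) ∘ ρ⇐ ≈⟨ (refl⟩∘⟨ p) ⟩∘⟨refl ⟩
    (ρ⇒ ∘ (g ⊗₁ id)) ∘ ρ⇐ ≈⟨ ρ-natural ⟩∘⟨refl ⟩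
    (g ∘ ρ⇒) ∘ ρ⇐ ≈⟨ cancelʳ ρ-isoʳ ⟩
    g ∎

  cancel-⊗unitˡ : ∀ {A B} {f g : A ⇒ B} → id {unit} ⊗₁ f ≈ id ⊗₁ g → f ≈ g
  cancel-⊗unitˡ {f = f} {g} p = begin
    f ≈⟨ insertʳ λ-isoʳ ⟩
    (f ∘ λ⇒) ∘ λ⇐ ≈⟨ ≈sym λ-natural ⟩∘⟨refl ⟩
    (λ⇒ ∘ (id ⊗₁ f)) ∘ λ⇐ ≈⟨ (refl⟩∘⟨ p) ⟩∘⟨refl ⟩
    (λ⇒ ∘ (id ⊗₁ g)) ∘ λ⇐ ≈⟨ λ-natural ⟩∘⟨refl ⟩
    (g ∘ λ⇒) ∘ λ⇐ ≈⟨ cancelʳ λ-isoʳ ⟩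
    g ∎

  coherence₁ : ∀ {A B} → λ⇒ {A ⊗₀ B} ∘ α⇒ {unit} {A} {B} ≈ λ⇒ ⊗₁ id {B}
  coherence₁ {A} {B} = cancel-⊗unitˡ (cancel-isoʳ α⇒²-iso eq)
    where
    α⇒²-iso : (α⇒ {unit} {unit ⊗₀ A} {B} ∘ (α⇒ {unit} {unit} {A} ⊗₁ id {B})) ∘ ((α⇐ ⊗₁ id) ∘ α⇐) ≈ id
    α⇒²-iso = comp-iso (⊗id-iso α-isoʳ) α-isoʳ
    eq : (id ⊗₁ (λ⇒ ∘ α⇒)) ∘ (α⇒ ∘ (α⇒ ⊗₁ id)) ≈ (id ⊗₁ (λ⇒ ⊗₁ id)) ∘ (α⇒ ∘ (α⇒ ⊗₁ id))
    eq = begin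
      (id ⊗₁ (λ⇒ ∘ α⇒)) ∘ (α⇒ ∘ (α⇒ ⊗₁ id)) ≈⟨ id⊗∘ ⟩∘⟨refl ⟩
      ((id ⊗₁ λ⇒) ∘ (id ⊗₁ α⇒)) ∘ (α⇒ ∘ (α⇒ ⊗₁ id)) ≈⟨ assoc ⟩
      (id ⊗₁ λ⇒) ∘ ((id ⊗₁ α⇒) ∘ (α⇒ ∘ (α⇒ ⊗₁ id))) ≈⟨ refl⟩∘⟨ pentagon ⟩
      (id ⊗₁ λ⇒) ∘ (α⇒ ∘ α⇒) ≈⟨ pullˡ triangle ⟩
      (ρ⇒ ⊗₁ id) ∘ α⇒ ≈⟨ (≈refl ⟩⊗⟨ ≈sym ⊗-identity) ⟩∘⟨refl ⟩
      (ρ⇒ ⊗₁ (id ⊗₁ id)) ∘ α⇒ ≈⟨ ≈sym α-natural ⟩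
      α⇒ ∘ ((ρ⇒ ⊗₁ id) ⊗₁ id) ≈⟨ refl⟩∘⟨ (≈sym triangle ⟩⊗⟨ ≈refl) ⟩
      α⇒ ∘ (((id ⊗₁ λ⇒) ∘ α⇒) ⊗₁ id) ≈⟨ refl⟩∘⟨ ∘⊗id ⟩
      α⇒ ∘ (((id ⊗₁ λ⇒) ⊗₁ id) ∘ (α⇒ ⊗₁ id)) ≈⟨ sym-assoc ⟩
      (α⇒ ∘ ((id ⊗₁ λ⇒) ⊗₁ id)) ∘ (α⇒ ⊗₁ id) ≈⟨ α-natural ⟩∘⟨refl ⟩
      ((id ⊗₁ (λ⇒ ⊗₁ id)) ∘ α⇒) ∘ (α⇒ ⊗₁ id) ≈⟨ assoc ⟩
      (id ⊗₁ (λ⇒ ⊗₁ id)) ∘ (α⇒ ∘ (α⇒ ⊗₁ id)) ∎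

  coherence₂ : ∀ {A B} → (id {A} ⊗₁ ρ⇒ {B}) ∘ α⇒ ≈ ρ⇒ {A ⊗₀ B}
  coherence₂ {A} {B} = cancel-⊗unitʳ (cancel-isoˡ α-isoˡ eq)
    where
    eq : α⇒ ∘ (((id ⊗₁ ρ⇒) ∘ α⇒) ⊗₁ id) ≈ α⇒ ∘ (ρ⇒ {A ⊗₀ B} ⊗₁ id {unit})
    eq = begin
      α⇒ ∘ (((id ⊗₁ ρ⇒) ∘ α⇒) ⊗₁ id) ≈⟨ refl⟩∘⟨ ∘⊗id ⟩
      α⇒ ∘ (((id ⊗₁ ρ⇒) ⊗₁ id) ∘ (α⇒ ⊗₁ id)) ≈⟨ pullˡ α-natural ⟩
      ((id ⊗₁ (ρ⇒ ⊗₁ id)) ∘ α⇒) ∘ (α⇒ ⊗₁ id) ≈⟨ (≈refl ⟩⊗⟨ ≈sym triangle) ⟩∘⟨refl ⟩∘⟨refl ⟩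
      ((id ⊗₁ ((id ⊗₁ λ⇒) ∘ α⇒)) ∘ α⇒) ∘ (α⇒ ⊗₁ id) ≈⟨ id⊗∘ ⟩∘⟨refl ⟩∘⟨refl ⟩
      (((id ⊗₁ (id ⊗₁ λ⇒)) ∘ (id ⊗₁ α⇒)) ∘ α⇒) ∘ (α⇒ ⊗₁ id) ≈⟨ assoc ⟩
      ((id ⊗₁ (id ⊗₁ λ⇒)) ∘ (id ⊗₁ α⇒)) ∘ (α⇒ ∘ (α⇒ ⊗₁ id)) ≈⟨ assoc ⟩
      (id ⊗₁ (id ⊗₁ λ⇒)) ∘ ((id ⊗₁ α⇒) ∘ (α⇒ ∘ (α⇒ ⊗₁ id))) ≈⟨ refl⟩∘⟨ pentagon ⟩
      (id ⊗₁ (id ⊗₁ λ⇒)) ∘ (α⇒ ∘ α⇒) ≈⟨ pullˡ (≈sym α-natural) ⟩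
      (α⇒ ∘ ((id ⊗₁ id) ⊗₁ λ⇒)) ∘ α⇒ ≈⟨ assoc ⟩
      α⇒ ∘ (((id ⊗₁ id) ⊗₁ λ⇒) ∘ α⇒) ≈⟨ refl⟩∘⟨ ((⊗-identity ⟩⊗⟨ ≈refl) ⟩∘⟨refl) ⟩
      α⇒ ∘ ((id ⊗₁ λ⇒) ∘ α⇒) ≈⟨ refl⟩∘⟨ triangle ⟩
      α⇒ ∘ (ρ⇒ ⊗₁ id) ∎

  braiding-coherence : ∀ {A} → λ⇒ ∘ σ {A} {unit} ≈ ρ⇒
  braiding-coherence {A} = ≈sym (cancel-⊗unitʳ (cancel-isoˡ σ-involutive eq))
    where
    eq : σ ∘ (ρ⇒ {A} ⊗₁ id {unit}) ≈ σ ∘ ((λ⇒ ∘ σ) ⊗₁ id)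
    eq = begin
      σ ∘ (ρ⇒ ⊗₁ id) ≈⟨ refl⟩∘⟨ ≈sym triangle ⟩
      σ ∘ ((id ⊗₁ λ⇒) ∘ α⇒) ≈⟨ pullˡ σ-natural ⟩
      ((λ⇒ ⊗₁ id) ∘ σ) ∘ α⇒ ≈⟨ ≈sym coherence₁ ⟩∘⟨refl ⟩∘⟨refl ⟩
      ((λ⇒ ∘ α⇒) ∘ σ) ∘ α⇒ ≈⟨ assoc ⟩
      (λ⇒ ∘ α⇒) ∘ (σ ∘ α⇒) ≈⟨ assoc ⟩
      λ⇒ ∘ (α⇒ ∘ (σ ∘ α⇒)) ≈⟨ refl⟩∘⟨ hexagon ⟩
      λ⇒ ∘ ((id ⊗₁ σ) ∘ (α⇒ ∘ (σ ⊗₁ id))) ≈⟨ pullˡ λ-natural ⟩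
      (σ ∘ λ⇒) ∘ (α⇒ ∘ (σ ⊗₁ id)) ≈⟨ assoc ⟩
      σ ∘ (λ⇒ ∘ (α⇒ ∘ (σ ⊗₁ id))) ≈⟨ refl⟩∘⟨ pullˡ coherence₁ ⟩
      σ ∘ ((λ⇒ ⊗₁ id) ∘ (σ ⊗₁ id)) ≈⟨ refl⟩∘⟨ ≈sym ∘⊗id ⟩
      σ ∘ ((λ⇒ ∘ σ) ⊗₁ id) ∎

  σ-unitˡ : ∀ {W} → σ {unit} {W} ≈ ρ⇐ ∘ λ⇒
  σ-unitˡ = ≈sym (begin
    ρ⇐ ∘ λ⇒ ≈⟨ refl⟩∘⟨ insertʳ σ-involutive ⟩
    ρ⇐ ∘ ((λ⇒ ∘ σ) ∘ σ) ≈⟨ refl⟩∘⟨ (braiding-coherence ⟩∘⟨refl) ⟩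
    ρ⇐ ∘ (ρ⇒ ∘ σ) ≈⟨ cancelˡ ρ-isoˡ ⟩
    σ ∎)

  coherence-inv₂ : ∀ {A B} → α⇐ ∘ (id {A} ⊗₁ ρ⇐ {B}) ≈ ρ⇐
  coherence-inv₂ = inv-unique coherence₂ (comp-iso (id⊗-iso ρ-isoˡ) α-isoˡ) ρ-isoʳ

  swapʳ : ∀ {A B C} → (A ⊗₀ B) ⊗₀ C ⇒ (A ⊗₀ C) ⊗₀ B
  swapʳ = α⇐ ∘ ((id ⊗₁ σ) ∘ α⇒)

  swapʳ-unit₂ : ∀ {Y W} → swapʳ {Y} {unit} {W} ≈ ρ⇐ ∘ (ρ⇒ ⊗₁ id)
  swapʳ-unit₂ = begin
    α⇐ ∘ ((id ⊗₁ σ) ∘ α⇒) ≈⟨ refl⟩∘⟨ ((≈refl ⟩⊗⟨ σ-unitˡ) ⟩∘⟨refl) ⟩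
    α⇐ ∘ ((id ⊗₁ (ρ⇐ ∘ λ⇒)) ∘ α⇒) ≈⟨ refl⟩∘⟨ (id⊗∘ ⟩∘⟨refl) ⟩
    α⇐ ∘ (((id ⊗₁ ρ⇐) ∘ (id ⊗₁ λ⇒)) ∘ α⇒) ≈⟨ refl⟩∘⟨ assoc ⟩
    α⇐ ∘ ((id ⊗₁ ρ⇐) ∘ ((id ⊗₁ λ⇒) ∘ α⇒)) ≈⟨ pullˡ coherence-inv₂ ⟩
    ρ⇐ ∘ ((id ⊗₁ λ⇒) ∘ α⇒) ≈⟨ refl⟩∘⟨ triangle ⟩
    ρ⇐ ∘ (ρ⇒ ⊗₁ id) ∎

  swapʳ-involutive : ∀ {A B C} → swapʳ {A} {C} {B} ∘ swapʳ {A} {B} {C} ≈ id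
  swapʳ-involutive = begin
    (α⇐ ∘ ((id ⊗₁ σ) ∘ α⇒)) ∘ (α⇐ ∘ ((id ⊗₁ σ) ∘ α⇒)) ≈⟨ assoc ⟩
    α⇐ ∘ (((id ⊗₁ σ) ∘ α⇒) ∘ (α⇐ ∘ ((id ⊗₁ σ) ∘ α⇒))) ≈⟨ refl⟩∘⟨ assoc ⟩
    α⇐ ∘ ((id ⊗₁ σ) ∘ (α⇒ ∘ (α⇐ ∘ ((id ⊗₁ σ) ∘ α⇒)))) ≈⟨ refl⟩∘⟨ refl⟩∘⟨ cancelˡ α-isoʳ ⟩
    α⇐ ∘ ((id ⊗₁ σ) ∘ ((id ⊗₁ σ) ∘ α⇒)) ≈⟨ refl⟩∘⟨ cancelˡ (id⊗-iso σ-involutive) ⟩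
    α⇐ ∘ α⇒ ≈⟨ α-isoˡ ⟩
    id ∎

  id⊗σ-natural : ∀ {A A′ B B′ C C′} {f : A ⇒ A′} {g : B ⇒ B′} {h : C ⇒ C′} →
                 (id ⊗₁ σ) ∘ (f ⊗₁ (g ⊗₁ h)) ≈ (f ⊗₁ (h ⊗₁ g)) ∘ (id ⊗₁ σ)
  id⊗σ-natural = begin
    (id ⊗₁ σ) ∘ (_ ⊗₁ (_ ⊗₁ _)) ≈⟨ ≈sym ⊗-homomorphism ⟩
    (id ∘ _) ⊗₁ (σ ∘ (_ ⊗₁ _)) ≈⟨ ≈trans identityˡ (≈sym identityʳ) ⟩⊗⟨ σ-natural ⟩
    (_ ∘ id) ⊗₁ ((_ ⊗₁ _) ∘ σ) ≈⟨ ⊗-homomorphism ⟩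
    (_ ⊗₁ (_ ⊗₁ _)) ∘ (id ⊗₁ σ) ∎

  swapʳ-unit₃ : ∀ {Y W} → swapʳ {Y} {W} {unit} ≈ (ρ⇐ ⊗₁ id) ∘ ρ⇒
  swapʳ-unit₃ = inv-unique swapʳ-unit₂ swapʳ-involutive (comp-iso (⊗id-iso ρ-isoʳ) ρ-isoˡ)

  swapʳ-natural : ∀ {A A′ B B′ C C′} {f : A ⇒ A′} {g : B ⇒ B′} {h : C ⇒ C′} →
                  swapʳ ∘ ((f ⊗₁ g) ⊗₁ h) ≈ ((f ⊗₁ h) ⊗₁ g) ∘ swapʳ
  swapʳ-natural = begin
    (α⇐ ∘ ((id ⊗₁ σ) ∘ α⇒)) ∘ ((_ ⊗₁ _) ⊗₁ _) ≈⟨ assoc ⟩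
    α⇐ ∘ (((id ⊗₁ σ) ∘ α⇒) ∘ ((_ ⊗₁ _) ⊗₁ _)) ≈⟨ refl⟩∘⟨ pullʳ α-natural ⟩
    α⇐ ∘ ((id ⊗₁ σ) ∘ ((_ ⊗₁ (_ ⊗₁ _)) ∘ α⇒)) ≈⟨ refl⟩∘⟨ pullˡ id⊗σ-natural ⟩
    α⇐ ∘ (((_ ⊗₁ (_ ⊗₁ _)) ∘ (id ⊗₁ σ)) ∘ α⇒) ≈⟨ refl⟩∘⟨ assoc ⟩
    α⇐ ∘ ((_ ⊗₁ (_ ⊗₁ _)) ∘ ((id ⊗₁ σ) ∘ α⇒)) ≈⟨ pullˡ α⇐-natural ⟩
    (((_ ⊗₁ _) ⊗₁ _) ∘ α⇐) ∘ ((id ⊗₁ σ) ∘ α⇒) ≈⟨ assoc ⟩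
    ((_ ⊗₁ _) ⊗₁ _) ∘ swapʳ ∎

  hexagon⁻¹ : ∀ {A B C} → α⇐ {C} {A} {B} ∘ (σ {A ⊗₀ B} {C} ∘ α⇐ {A} {B} {C})
              ≈ (σ {A} {C} ⊗₁ id {B}) ∘ (α⇐ {A} {C} {B} ∘ (id {A} ⊗₁ σ {B} {C}))
  hexagon⁻¹ = inv-unique hexagon (comp3-iso α-isoˡ σ-involutive α-isoˡ)
                (comp3-iso (⊗id-iso σ-involutive) α-isoʳ (id⊗-iso σ-involutive))

  hexagon-swapʳ : ∀ {W A U} → α⇒ {W} {A} {U} ∘ (σ {A} {W} ⊗₁ id {U}) ≈ σ {A ⊗₀ U} {W} ∘ swapʳ {A} {W} {U}
  hexagon-swapʳ = ≈sym (begin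
    σ ∘ (α⇐ ∘ ((id ⊗₁ σ) ∘ α⇒)) ≈⟨ insertˡ α-isoʳ ⟩
    α⇒ ∘ (α⇐ ∘ (σ ∘ (α⇐ ∘ ((id ⊗₁ σ) ∘ α⇒)))) ≈⟨ refl⟩∘⟨ ≈sym (≈trans assoc (refl⟩∘⟨ assoc)) ⟩
    α⇒ ∘ ((α⇐ ∘ (σ ∘ α⇐)) ∘ ((id ⊗₁ σ) ∘ α⇒)) ≈⟨ refl⟩∘⟨ (hexagon⁻¹ ⟩∘⟨refl) ⟩
    α⇒ ∘ (((σ ⊗₁ id) ∘ (α⇐ ∘ (id ⊗₁ σ))) ∘ ((id ⊗₁ σ) ∘ α⇒)) ≈⟨ refl⟩∘⟨ ≈trans assoc (refl⟩∘⟨ assoc) ⟩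
    α⇒ ∘ ((σ ⊗₁ id) ∘ (α⇐ ∘ ((id ⊗₁ σ) ∘ ((id ⊗₁ σ) ∘ α⇒)))) ≈⟨ refl⟩∘⟨ refl⟩∘⟨ refl⟩∘⟨ cancelˡ (id⊗-iso σ-involutive) ⟩
    α⇒ ∘ ((σ ⊗₁ id) ∘ (α⇐ ∘ α⇒)) ≈⟨ refl⟩∘⟨ refl⟩∘⟨ α-isoˡ ⟩
    α⇒ ∘ ((σ ⊗₁ id) ∘ id) ≈⟨ refl⟩∘⟨ identityʳ ⟩
    α⇒ ∘ (σ ⊗₁ id) ∎)

  swapʳ-from-σ : ∀ {W B U} → (σ {W} {B} ⊗₁ id {U}) ∘ (α⇐ {W} {B} {U} ∘ σ {B ⊗₀ U} {W}) ≈ swapʳ {B} {U} {W}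
  swapʳ-from-σ {W} {B} {U} = ≈trans sym-assoc (≈trans (hexagon-swapʳ-inverted ⟩∘⟨refl) (cancelʳ σ-involutive))
    where
    hexagon-swapʳ-inverted :
      (σ {W} {B} ⊗₁ id {U}) ∘ α⇐ {W} {B} {U} ≈ swapʳ {B} {U} {W} ∘ σ {W} {B ⊗₀ U}
    hexagon-swapʳ-inverted = inv-unique hexagon-swapʳ (comp-iso α-isoˡ (⊗id-iso σ-involutive)) (comp-iso swapʳ-involutive σ-involutive)

  pentagon-α⇐ : ∀ {A B C D} → α⇒ {A} {B ⊗₀ C} {D} ∘ (α⇒ {A} {B} {C} ⊗₁ id {D})
                ≈ (id ⊗₁ α⇐) ∘ (α⇒ ∘ α⇒)
  pentagon-α⇐ = switch-fromˡ (id⊗-iso α-isoˡ) pentagon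

  pentagon-α⇐′ : ∀ {A B C D} → α⇒ {A} {B ⊗₀ C} {D} ∘ ((α⇒ {A} {B} {C} ⊗₁ id {D}) ∘ α⇐)
                 ≈ (id ⊗₁ α⇐) ∘ α⇒
  pentagon-α⇐′ = begin
    α⇒ ∘ ((α⇒ ⊗₁ id) ∘ α⇐) ≈⟨ sym-assoc ⟩
    (α⇒ ∘ (α⇒ ⊗₁ id)) ∘ α⇐ ≈⟨ pentagon-α⇐ ⟩∘⟨refl ⟩
    ((id ⊗₁ α⇐) ∘ (α⇒ ∘ α⇒)) ∘ α⇐ ≈⟨ ≈trans assoc (refl⟩∘⟨ assoc) ⟩
    (id ⊗₁ α⇐) ∘ (α⇒ ∘ (α⇒ ∘ α⇐)) ≈⟨ refl⟩∘⟨ refl⟩∘⟨ α-isoʳ ⟩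
    (id ⊗₁ α⇐) ∘ (α⇒ ∘ id) ≈⟨ refl⟩∘⟨ identityʳ ⟩
    (id ⊗₁ α⇐) ∘ α⇒ ∎

  α⇒∘swapʳ : ∀ {A B C} → α⇒ ∘ swapʳ {A} {B} {C} ≈ (id ⊗₁ σ) ∘ α⇒
  α⇒∘swapʳ = cancelˡ α-isoʳ

  swapʳ∘α⇐ : ∀ {A B C} → swapʳ {A} {B} {C} ∘ α⇐ ≈ α⇐ ∘ (id ⊗₁ σ)
  swapʳ∘α⇐ = ≈trans assoc (refl⟩∘⟨ cancelʳ α-isoʳ)

  swapʳ-⊗ : ∀ {A W V U} → (swapʳ {A} {W} {U} ⊗₁ id {V}) ∘ swapʳ {A ⊗₀ W} {V} {U}
            ≈ α⇐ {A ⊗₀ U} {W} {V} ∘ (swapʳ {A} {W ⊗₀ V} {U} ∘ (α⇒ {A} {W} {V} ⊗₁ id {U}))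
  swapʳ-⊗ {A} {W} {V} {U} = cancel-isoˡ (comp-iso α-isoˡ α-isoˡ) (≈trans lhs (≈sym rhs))
    where
    normal-form : α⇒ {A} {U} {W ⊗₀ V} ∘ (α⇒ {A ⊗₀ U} {W} {V} ∘ ((swapʳ ⊗₁ id) ∘ α⇐))
                  ≈ (id ⊗₁ α⇒) ∘ ((id ⊗₁ (σ ⊗₁ id)) ∘ ((id ⊗₁ α⇐) ∘ α⇒))
    normal-form = begin
      α⇒ ∘ (α⇒ ∘ ((swapʳ ⊗₁ id) ∘ α⇐)) ≈⟨ sym-assoc ⟩
      (α⇒ ∘ α⇒) ∘ ((swapʳ ⊗₁ id) ∘ α⇐) ≈⟨ ≈sym pentagon ⟩∘⟨refl ⟩
      ((id ⊗₁ α⇒) ∘ (α⇒ ∘ (α⇒ ⊗₁ id))) ∘ ((swapʳ ⊗₁ id) ∘ α⇐) ≈⟨ ≈trans assoc (refl⟩∘⟨ assoc) ⟩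
      (id ⊗₁ α⇒) ∘ (α⇒ ∘ ((α⇒ ⊗₁ id) ∘ ((swapʳ ⊗₁ id) ∘ α⇐))) ≈⟨ refl⟩∘⟨ refl⟩∘⟨ pullˡ (≈sym ∘⊗id) ⟩
      (id ⊗₁ α⇒) ∘ (α⇒ ∘ (((α⇒ ∘ swapʳ) ⊗₁ id) ∘ α⇐)) ≈⟨ refl⟩∘⟨ refl⟩∘⟨ ((α⇒∘swapʳ ⟩⊗⟨ ≈refl) ⟩∘⟨refl) ⟩
      (id ⊗₁ α⇒) ∘ (α⇒ ∘ ((((id ⊗₁ σ) ∘ α⇒) ⊗₁ id) ∘ α⇐)) ≈⟨ refl⟩∘⟨ refl⟩∘⟨ (∘⊗id ⟩∘⟨refl) ⟩
      (id ⊗₁ α⇒) ∘ (α⇒ ∘ ((((id ⊗₁ σ) ⊗₁ id) ∘ (α⇒ ⊗₁ id)) ∘ α⇐)) ≈⟨ refl⟩∘⟨ refl⟩∘⟨ assoc ⟩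
      (id ⊗₁ α⇒) ∘ (α⇒ ∘ (((id ⊗₁ σ) ⊗₁ id) ∘ ((α⇒ ⊗₁ id) ∘ α⇐))) ≈⟨ refl⟩∘⟨ pullˡ α-natural ⟩
      (id ⊗₁ α⇒) ∘ (((id ⊗₁ (σ ⊗₁ id)) ∘ α⇒) ∘ ((α⇒ ⊗₁ id) ∘ α⇐)) ≈⟨ refl⟩∘⟨ assoc ⟩
      (id ⊗₁ α⇒) ∘ ((id ⊗₁ (σ ⊗₁ id)) ∘ (α⇒ ∘ ((α⇒ ⊗₁ id) ∘ α⇐))) ≈⟨ refl⟩∘⟨ refl⟩∘⟨ pentagon-α⇐′ ⟩
      (id ⊗₁ α⇒) ∘ ((id ⊗₁ (σ ⊗₁ id)) ∘ ((id ⊗₁ α⇐) ∘ α⇒)) ∎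
    lhs : (α⇒ ∘ α⇒) ∘ ((swapʳ ⊗₁ id) ∘ swapʳ)
          ≈ (id ⊗₁ α⇒) ∘ ((id ⊗₁ (σ ⊗₁ id)) ∘ ((id ⊗₁ α⇐) ∘ (α⇒ ∘ ((id ⊗₁ σ) ∘ α⇒))))
    lhs = begin
      (α⇒ ∘ α⇒) ∘ ((swapʳ ⊗₁ id) ∘ (α⇐ ∘ ((id ⊗₁ σ) ∘ α⇒))) ≈⟨ assoc ⟩
      α⇒ ∘ (α⇒ ∘ ((swapʳ ⊗₁ id) ∘ (α⇐ ∘ ((id ⊗₁ σ) ∘ α⇒)))) ≈⟨ refl⟩∘⟨ refl⟩∘⟨ sym-assoc ⟩
      α⇒ ∘ (α⇒ ∘ (((swapʳ ⊗₁ id) ∘ α⇐) ∘ ((id ⊗₁ σ) ∘ α⇒))) ≈⟨ refl⟩∘⟨ sym-assoc ⟩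
      α⇒ ∘ ((α⇒ ∘ ((swapʳ ⊗₁ id) ∘ α⇐)) ∘ ((id ⊗₁ σ) ∘ α⇒)) ≈⟨ sym-assoc ⟩
      (α⇒ ∘ (α⇒ ∘ ((swapʳ ⊗₁ id) ∘ α⇐))) ∘ ((id ⊗₁ σ) ∘ α⇒) ≈⟨ normal-form ⟩∘⟨refl ⟩
      ((id ⊗₁ α⇒) ∘ ((id ⊗₁ (σ ⊗₁ id)) ∘ ((id ⊗₁ α⇐) ∘ α⇒))) ∘ ((id ⊗₁ σ) ∘ α⇒) ≈⟨ ≈trans assoc (refl⟩∘⟨ ≈trans assoc (refl⟩∘⟨ assoc)) ⟩
      (id ⊗₁ α⇒) ∘ ((id ⊗₁ (σ ⊗₁ id)) ∘ ((id ⊗₁ α⇐) ∘ (α⇒ ∘ ((id ⊗₁ σ) ∘ α⇒)))) ∎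
    rhs : (α⇒ ∘ α⇒) ∘ (α⇐ ∘ (swapʳ ∘ (α⇒ ⊗₁ id)))
          ≈ (id ⊗₁ α⇒) ∘ ((id ⊗₁ (σ ⊗₁ id)) ∘ ((id ⊗₁ α⇐) ∘ (α⇒ ∘ ((id ⊗₁ σ) ∘ α⇒))))
    rhs = begin
      (α⇒ ∘ α⇒) ∘ (α⇐ ∘ (swapʳ ∘ (α⇒ ⊗₁ id))) ≈⟨ assoc ⟩
      α⇒ ∘ (α⇒ ∘ (α⇐ ∘ (swapʳ ∘ (α⇒ ⊗₁ id)))) ≈⟨ refl⟩∘⟨ cancelˡ α-isoʳ ⟩
      α⇒ ∘ ((α⇐ ∘ ((id ⊗₁ σ) ∘ α⇒)) ∘ (α⇒ ⊗₁ id)) ≈⟨ refl⟩∘⟨ assoc ⟩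
      α⇒ ∘ (α⇐ ∘ (((id ⊗₁ σ) ∘ α⇒) ∘ (α⇒ ⊗₁ id))) ≈⟨ cancelˡ α-isoʳ ⟩
      ((id ⊗₁ σ) ∘ α⇒) ∘ (α⇒ ⊗₁ id) ≈⟨ assoc ⟩
      (id ⊗₁ σ) ∘ (α⇒ ∘ (α⇒ ⊗₁ id)) ≈⟨ refl⟩∘⟨ pentagon-α⇐ ⟩
      (id ⊗₁ σ) ∘ ((id ⊗₁ α⇐) ∘ (α⇒ ∘ α⇒)) ≈⟨ sym-assoc ⟩
      ((id ⊗₁ σ) ∘ (id ⊗₁ α⇐)) ∘ (α⇒ ∘ α⇒) ≈⟨ ≈sym id⊗∘ ⟩∘⟨refl ⟩
      (id ⊗₁ (σ ∘ α⇐)) ∘ (α⇒ ∘ α⇒) ≈⟨ (≈refl ⟩⊗⟨ switch-fromˡ α-isoʳ hexagon⁻¹) ⟩∘⟨refl ⟩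
      (id ⊗₁ (α⇒ ∘ ((σ ⊗₁ id) ∘ (α⇐ ∘ (id ⊗₁ σ))))) ∘ (α⇒ ∘ α⇒) ≈⟨ ≈trans id⊗∘ (refl⟩∘⟨ ≈trans id⊗∘ (refl⟩∘⟨ id⊗∘)) ⟩∘⟨refl ⟩
      ((id ⊗₁ α⇒) ∘ ((id ⊗₁ (σ ⊗₁ id)) ∘ ((id ⊗₁ α⇐) ∘ (id ⊗₁ (id ⊗₁ σ))))) ∘ (α⇒ ∘ α⇒) ≈⟨ ≈trans assoc (refl⟩∘⟨ ≈trans assoc (refl⟩∘⟨ assoc)) ⟩
      (id ⊗₁ α⇒) ∘ ((id ⊗₁ (σ ⊗₁ id)) ∘ ((id ⊗₁ α⇐) ∘ ((id ⊗₁ (id ⊗₁ σ)) ∘ (α⇒ ∘ α⇒)))) ≈⟨ refl⟩∘⟨ refl⟩∘⟨ refl⟩∘⟨ pullˡ (≈sym α-natural) ⟩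
      (id ⊗₁ α⇒) ∘ ((id ⊗₁ (σ ⊗₁ id)) ∘ ((id ⊗₁ α⇐) ∘ ((α⇒ ∘ ((id ⊗₁ id) ⊗₁ σ)) ∘ α⇒))) ≈⟨ refl⟩∘⟨ refl⟩∘⟨ refl⟩∘⟨ ≈trans assoc (refl⟩∘⟨ ((⊗-identity ⟩⊗⟨ ≈refl) ⟩∘⟨refl)) ⟩
      (id ⊗₁ α⇒) ∘ ((id ⊗₁ (σ ⊗₁ id)) ∘ ((id ⊗₁ α⇐) ∘ (α⇒ ∘ ((id ⊗₁ σ) ∘ α⇒)))) ∎

  swapʳ-yang-baxter : ∀ {A W V U} →
                      swapʳ {A ⊗₀ U} {W} {V} ∘ ((swapʳ {A} {W} {U} ⊗₁ id {V}) ∘ swapʳ {A ⊗₀ W} {V} {U})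
                      ≈ (swapʳ {A} {V} {U} ⊗₁ id {W}) ∘ (swapʳ {A ⊗₀ V} {W} {U} ∘ (swapʳ {A} {W} {V} ⊗₁ id {U}))
  swapʳ-yang-baxter = begin
    swapʳ ∘ ((swapʳ ⊗₁ id) ∘ swapʳ) ≈⟨ refl⟩∘⟨ swapʳ-⊗ ⟩
    swapʳ ∘ (α⇐ ∘ (swapʳ ∘ (α⇒ ⊗₁ id))) ≈⟨ pullˡ swapʳ∘α⇐ ⟩
    (α⇐ ∘ (id ⊗₁ σ)) ∘ (swapʳ ∘ (α⇒ ⊗₁ id)) ≈⟨ assoc ⟩
    α⇐ ∘ ((id ⊗₁ σ) ∘ (swapʳ ∘ (α⇒ ⊗₁ id))) ≈⟨ refl⟩∘⟨ pullˡ (≈trans ((≈sym ⊗-identity) ⟩⊗⟨ ≈refl ⟩∘⟨refl) (≈sym swapʳ-natural)) ⟩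
    α⇐ ∘ ((swapʳ ∘ ((id ⊗₁ σ) ⊗₁ id)) ∘ (α⇒ ⊗₁ id)) ≈⟨ refl⟩∘⟨ assoc ⟩
    α⇐ ∘ (swapʳ ∘ (((id ⊗₁ σ) ⊗₁ id) ∘ (α⇒ ⊗₁ id))) ≈⟨ refl⟩∘⟨ refl⟩∘⟨ ≈sym ∘⊗id ⟩
    α⇐ ∘ (swapʳ ∘ (((id ⊗₁ σ) ∘ α⇒) ⊗₁ id)) ≈⟨ refl⟩∘⟨ refl⟩∘⟨ (≈sym α⇒∘swapʳ ⟩⊗⟨ ≈refl) ⟩
    α⇐ ∘ (swapʳ ∘ ((α⇒ ∘ swapʳ) ⊗₁ id)) ≈⟨ refl⟩∘⟨ refl⟩∘⟨ ∘⊗id ⟩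
    α⇐ ∘ (swapʳ ∘ ((α⇒ ⊗₁ id) ∘ (swapʳ ⊗₁ id))) ≈⟨ ≈sym (≈trans assoc (refl⟩∘⟨ assoc)) ⟩
    (α⇐ ∘ (swapʳ ∘ (α⇒ ⊗₁ id))) ∘ (swapʳ ⊗₁ id) ≈⟨ ≈sym swapʳ-⊗ ⟩∘⟨refl ⟩
    ((swapʳ ⊗₁ id) ∘ swapʳ) ∘ (swapʳ ⊗₁ id) ≈⟨ assoc ⟩
    (swapʳ ⊗₁ id) ∘ (swapʳ ∘ (swapʳ ⊗₁ id)) ∎

module TracedProperties {o ℓ e} {𝒞 : Category o ℓ e} {S : SymmetricMonoidal 𝒞} (T : Trace 𝒞 S) where
  open MonoidalProperties S public
  open Trace T public

  tighteningʳ : ∀ {A A′ B X} {F : A ⊗₀ X ⇒ B ⊗₀ X} {M : A′ ⇒ A} → Tr F ∘ M ≈ Tr (F ∘ (M ⊗₁ id))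
  tighteningʳ {F = F} {M} = ≈sym (begin
    Tr (F ∘ (M ⊗₁ id)) ≈⟨ Tr-resp-≈ (≈sym (≈trans (⊗-identity ⟩∘⟨refl) identityˡ)) ⟩
    Tr ((id ⊗₁ id) ∘ (F ∘ (M ⊗₁ id))) ≈⟨ tightening ⟩
    id ∘ (Tr F ∘ M) ≈⟨ identityˡ ⟩
    Tr F ∘ M ∎)

  tighteningˡ : ∀ {A B B′ X} {F : A ⊗₀ X ⇒ B ⊗₀ X} {h : B ⇒ B′} → h ∘ Tr F ≈ Tr ((h ⊗₁ id) ∘ F)
  tighteningˡ {F = F} {h} = ≈sym (begin
    Tr ((h ⊗₁ id) ∘ F) ≈⟨ Tr-resp-≈ (refl⟩∘⟨ ≈sym (≈trans (refl⟩∘⟨ ⊗-identity) identityʳ)) ⟩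
    Tr ((h ⊗₁ id) ∘ (F ∘ (id ⊗₁ id))) ≈⟨ tightening ⟩
    h ∘ (Tr F ∘ id) ≈⟨ refl⟩∘⟨ identityʳ ⟩
    h ∘ Tr F ∎)

  Tr-interchange : ∀ {A B U V} {Q : (A ⊗₀ U) ⊗₀ V ⇒ (B ⊗₀ U) ⊗₀ V} →
                   Tr {X = U} (Tr {X = V} Q) ≈ Tr {X = V} (Tr {X = U} (swapʳ ∘ (Q ∘ swapʳ)))
  Tr-interchange {A} {B} {U} {V} {Q} = begin
    Tr (Tr Q) ≈⟨ Tr-resp-≈ (Tr-resp-≈ α-round-trip) ⟩
    Tr (Tr (α⇐ ∘ ((α⇒ ∘ (Q ∘ α⇐)) ∘ α⇒))) ≈⟨ ≈sym vanishing₂ ⟩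
    Tr (α⇒ ∘ (Q ∘ α⇐)) ≈⟨ Tr-resp-≈ (insertʳ (id⊗-iso σ-involutive)) ⟩
    Tr (((α⇒ ∘ (Q ∘ α⇐)) ∘ (id ⊗₁ σ {V} {U})) ∘ (id ⊗₁ σ {U} {V})) ≈⟨ ≈sym sliding ⟩
    Tr ((id ⊗₁ σ {U} {V}) ∘ ((α⇒ ∘ (Q ∘ α⇐)) ∘ (id ⊗₁ σ {V} {U}))) ≈⟨ vanishing₂ ⟩
    Tr (Tr (α⇐ ∘ (((id ⊗₁ σ) ∘ ((α⇒ ∘ (Q ∘ α⇐)) ∘ (id ⊗₁ σ))) ∘ α⇒))) ≈⟨ Tr-resp-≈ (Tr-resp-≈ regroup) ⟩
    Tr (Tr (swapʳ ∘ (Q ∘ swapʳ))) ∎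
    where
    α-round-trip : Q ≈ α⇐ ∘ ((α⇒ ∘ (Q ∘ α⇐)) ∘ α⇒)
    α-round-trip = ≈sym (≈trans (refl⟩∘⟨ assoc) (≈trans (cancelˡ α-isoˡ) (≈trans assoc (≈trans (refl⟩∘⟨ α-isoˡ) identityʳ))))
    regroup : α⇐ ∘ (((id ⊗₁ σ) ∘ ((α⇒ ∘ (Q ∘ α⇐)) ∘ (id ⊗₁ σ))) ∘ α⇒)
          ≈ (α⇐ ∘ ((id ⊗₁ σ) ∘ α⇒)) ∘ (Q ∘ (α⇐ ∘ ((id ⊗₁ σ) ∘ α⇒)))
    regroup = begin
      α⇐ ∘ (((id ⊗₁ σ) ∘ ((α⇒ ∘ (Q ∘ α⇐)) ∘ (id ⊗₁ σ))) ∘ α⇒) ≈⟨ refl⟩∘⟨ assoc ⟩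
      α⇐ ∘ ((id ⊗₁ σ) ∘ (((α⇒ ∘ (Q ∘ α⇐)) ∘ (id ⊗₁ σ)) ∘ α⇒)) ≈⟨ refl⟩∘⟨ refl⟩∘⟨ assoc ⟩
      α⇐ ∘ ((id ⊗₁ σ) ∘ ((α⇒ ∘ (Q ∘ α⇐)) ∘ ((id ⊗₁ σ) ∘ α⇒))) ≈⟨ refl⟩∘⟨ refl⟩∘⟨ assoc ⟩
      α⇐ ∘ ((id ⊗₁ σ) ∘ (α⇒ ∘ ((Q ∘ α⇐) ∘ ((id ⊗₁ σ) ∘ α⇒)))) ≈⟨ refl⟩∘⟨ refl⟩∘⟨ refl⟩∘⟨ assoc ⟩
      α⇐ ∘ ((id ⊗₁ σ) ∘ (α⇒ ∘ (Q ∘ (α⇐ ∘ ((id ⊗₁ σ) ∘ α⇒))))) ≈⟨ ≈sym (≈trans assoc (refl⟩∘⟨ assoc)) ⟩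
      (α⇐ ∘ ((id ⊗₁ σ) ∘ α⇒)) ∘ (Q ∘ (α⇐ ∘ ((id ⊗₁ σ) ∘ α⇒))) ∎

  superposingʳ : ∀ {A B U W} {F : A ⊗₀ U ⇒ B ⊗₀ U} →
                 Tr F ⊗₁ id {W} ≈ Tr {X = U} (swapʳ {B} {U} {W} ∘ ((F ⊗₁ id) ∘ swapʳ {A} {W} {U}))
  superposingʳ {A} {B} {U} {W} {F} = begin
    Tr F ⊗₁ id ≈⟨ ≈sym (≈trans (refl⟩∘⟨ ≈sym σ-natural) (cancelˡ σ-involutive)) ⟩
    σ ∘ ((id ⊗₁ Tr F) ∘ σ) ≈⟨ refl⟩∘⟨ (≈sym superposing ⟩∘⟨refl) ⟩
    σ ∘ (Tr (α⇐ ∘ ((id ⊗₁ F) ∘ α⇒)) ∘ σ) ≈⟨ ≈sym tightening ⟩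
    Tr ((σ ⊗₁ id) ∘ ((α⇐ ∘ ((id ⊗₁ F) ∘ α⇒)) ∘ (σ ⊗₁ id))) ≈⟨ Tr-resp-≈ by-hexagons ⟩
    Tr (swapʳ ∘ ((F ⊗₁ id) ∘ swapʳ)) ∎
    where
    by-hexagons : (σ ⊗₁ id) ∘ ((α⇐ ∘ ((id ⊗₁ F) ∘ α⇒)) ∘ (σ {A} {W} ⊗₁ id)) ≈ swapʳ ∘ ((F ⊗₁ id) ∘ swapʳ)
    by-hexagons = begin
      (σ ⊗₁ id) ∘ ((α⇐ ∘ ((id ⊗₁ F) ∘ α⇒)) ∘ (σ ⊗₁ id)) ≈⟨ refl⟩∘⟨ ≈trans assoc (refl⟩∘⟨ assoc) ⟩
      (σ ⊗₁ id) ∘ (α⇐ ∘ ((id ⊗₁ F) ∘ (α⇒ ∘ (σ ⊗₁ id)))) ≈⟨ refl⟩∘⟨ refl⟩∘⟨ refl⟩∘⟨ hexagon-swapʳ ⟩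
      (σ ⊗₁ id) ∘ (α⇐ ∘ ((id ⊗₁ F) ∘ (σ ∘ swapʳ))) ≈⟨ refl⟩∘⟨ refl⟩∘⟨ pullˡ (≈sym σ-natural) ⟩
      (σ ⊗₁ id) ∘ (α⇐ ∘ ((σ ∘ (F ⊗₁ id)) ∘ swapʳ)) ≈⟨ refl⟩∘⟨ refl⟩∘⟨ assoc ⟩
      (σ ⊗₁ id) ∘ (α⇐ ∘ (σ ∘ ((F ⊗₁ id) ∘ swapʳ))) ≈⟨ ≈sym (≈trans assoc (refl⟩∘⟨ assoc)) ⟩
      ((σ ⊗₁ id) ∘ (α⇐ ∘ σ)) ∘ ((F ⊗₁ id) ∘ swapʳ) ≈⟨ swapʳ-from-σ ⟩∘⟨refl ⟩
      swapʳ ∘ ((F ⊗₁ id) ∘ swapʳ) ∎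

module IntProperties {o ℓ e} {𝒞 : Category o ℓ e} {S : SymmetricMonoidal 𝒞} (T : Trace 𝒞 S) where
  open TracedProperties T public
  open IntConstruction 𝒞 S T using (IntCompose; N)
  private
    module N = RawFunctor N

  -- Post-composition with g : (X , U) → (Y , V) in Int, transported along
  -- Int ((A , I) , (X , U)) ≅ 𝒞 (A ⊗ U , X); see ρ⇒∘IntCompose.
  act : ∀ {A U X Y V} → X ⊗₀ V ⇒ Y ⊗₀ U → A ⊗₀ U ⇒ X → A ⊗₀ V ⇒ Y
  act {U = U} g m = Tr {X = U} (g ∘ ((m ⊗₁ id) ∘ swapʳ))

  act-resp-≈ : ∀ {A U X Y V} {g g′ : X ⊗₀ V ⇒ Y ⊗₀ U} {m m′ : A ⊗₀ U ⇒ X} →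
               g ≈ g′ → m ≈ m′ → act g m ≈ act g′ m′
  act-resp-≈ p q = Tr-resp-≈ (p ⟩∘⟨ ((q ⟩⊗⟨ ≈refl) ⟩∘⟨refl))

  act-identity : ∀ {A U X} {m : A ⊗₀ U ⇒ X} → act id m ≈ m
  act-identity {m = m} = begin
    Tr (id ∘ ((m ⊗₁ id) ∘ swapʳ)) ≈⟨ Tr-resp-≈ (≈trans identityˡ (refl⟩∘⟨ ≈sym (≈trans (refl⟩∘⟨ ⊗-identity) identityʳ))) ⟩
    Tr ((m ⊗₁ id) ∘ (swapʳ ∘ (id ⊗₁ id))) ≈⟨ tightening ⟩
    m ∘ (Tr swapʳ ∘ id) ≈⟨ refl⟩∘⟨ identityʳ ⟩
    m ∘ Tr (α⇐ ∘ ((id ⊗₁ σ) ∘ α⇒)) ≈⟨ refl⟩∘⟨ superposing ⟩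
    m ∘ (id ⊗₁ Tr σ) ≈⟨ refl⟩∘⟨ (≈refl ⟩⊗⟨ yanking) ⟩
    m ∘ (id ⊗₁ id) ≈⟨ refl⟩∘⟨ ⊗-identity ⟩
    m ∘ id ≈⟨ identityʳ ⟩
    m ∎

  act-natural : ∀ {A A′ U X Y V} {g : X ⊗₀ V ⇒ Y ⊗₀ U} {m : A ⊗₀ U ⇒ X} {h : A′ ⇒ A} →
                act g (m ∘ (h ⊗₁ id)) ≈ act g m ∘ (h ⊗₁ id)
  act-natural {g = g} {m} {h} = begin
    Tr (g ∘ (((m ∘ (h ⊗₁ id)) ⊗₁ id) ∘ swapʳ)) ≈⟨ Tr-resp-≈ (refl⟩∘⟨ (∘⊗id ⟩∘⟨refl)) ⟩
    Tr (g ∘ (((m ⊗₁ id) ∘ ((h ⊗₁ id) ⊗₁ id)) ∘ swapʳ)) ≈⟨ Tr-resp-≈ (refl⟩∘⟨ assoc) ⟩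
    Tr (g ∘ ((m ⊗₁ id) ∘ (((h ⊗₁ id) ⊗₁ id) ∘ swapʳ))) ≈⟨ Tr-resp-≈ (refl⟩∘⟨ refl⟩∘⟨ ≈sym swapʳ-natural) ⟩
    Tr (g ∘ ((m ⊗₁ id) ∘ (swapʳ ∘ ((h ⊗₁ id) ⊗₁ id)))) ≈⟨ Tr-resp-≈ (≈sym (≈trans assoc (refl⟩∘⟨ assoc))) ⟩
    Tr ((g ∘ ((m ⊗₁ id) ∘ swapʳ)) ∘ ((h ⊗₁ id) ⊗₁ id)) ≈⟨ ≈sym tighteningʳ ⟩
    Tr (g ∘ ((m ⊗₁ id) ∘ swapʳ)) ∘ (h ⊗₁ id) ∎

  IntCompose-swapʳ : ∀ {X U Y V Z W} (g : Y ⊗₀ W ⇒ Z ⊗₀ V) (f : X ⊗₀ V ⇒ Y ⊗₀ U) →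
                     IntCompose {X , U} {Y , V} {Z , W} g f
                     ≈ Tr {X = V} (swapʳ ∘ ((g ⊗₁ id) ∘ (swapʳ ∘ ((f ⊗₁ id) ∘ swapʳ))))
  IntCompose-swapʳ g f = Tr-resp-≈ (≈trans reassociate (refl⟩∘⟨ refl⟩∘⟨ reassociate))
    where
    reassociate : ∀ {A B C D E} {a : D ⇒ E} {b : C ⇒ D} {c : B ⇒ C} {r : A ⇒ B} →
                  a ∘ (b ∘ (c ∘ r)) ≈ (a ∘ (b ∘ c)) ∘ r
    reassociate = ≈sym (≈trans assoc (refl⟩∘⟨ assoc))

  act-homomorphism : ∀ {A X U Y V Z W} (g : Y ⊗₀ W ⇒ Z ⊗₀ V) (f : X ⊗₀ V ⇒ Y ⊗₀ U) (m : A ⊗₀ U ⇒ X) →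
                     act (IntCompose {X , U} {Y , V} {Z , W} g f) m ≈ act g (act f m)
  act-homomorphism {A} {X} {U} {Y} {V} {Z} {W} g f m = begin
    act (IntCompose g f) m ≈⟨ act-resp-≈ (IntCompose-swapʳ g f) ≈refl ⟩
    Tr (Tr P ∘ ((m ⊗₁ id) ∘ swapʳ)) ≈⟨ Tr-resp-≈ tighteningʳ ⟩
    Tr (Tr (P ∘ (((m ⊗₁ id) ∘ swapʳ) ⊗₁ id))) ≈⟨ Tr-interchange ⟩
    Tr (Tr (swapʳ ∘ ((P ∘ (((m ⊗₁ id) ∘ swapʳ) ⊗₁ id)) ∘ swapʳ))) ≈⟨ Tr-resp-≈ (Tr-resp-≈ eqL) ⟩
    Tr {X = V} (Tr {X = U} (K TailL)) ≈⟨ Tr-resp-≈ (Tr-resp-≈ (refl⟩∘⟨ refl⟩∘⟨ refl⟩∘⟨ refl⟩∘⟨ swapʳ-yang-baxter)) ⟩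
    Tr {X = V} (Tr {X = U} (K TailR)) ≈⟨ Tr-resp-≈ (Tr-resp-≈ eqR) ⟩
    Tr {X = V} (Tr {X = U} ((g ⊗₁ id) ∘ ((swapʳ {Y} {U} {W} ∘ ((fm ⊗₁ id) ∘ swapʳ {A ⊗₀ V} {W} {U})) ∘ (swapʳ {A} {W} {V} ⊗₁ id)))) ≈⟨ Tr-resp-≈ tightening ⟩
    Tr {X = V} (g ∘ (Tr {X = U} (swapʳ ∘ ((fm ⊗₁ id) ∘ swapʳ)) ∘ swapʳ)) ≈⟨ Tr-resp-≈ (refl⟩∘⟨ (≈sym superposingʳ ⟩∘⟨refl)) ⟩
    Tr (g ∘ ((Tr fm ⊗₁ id) ∘ swapʳ)) ∎
    where
    P : (X ⊗₀ W) ⊗₀ V ⇒ (Z ⊗₀ U) ⊗₀ V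
    P = swapʳ ∘ ((g ⊗₁ id) ∘ (swapʳ ∘ ((f ⊗₁ id) ∘ swapʳ)))
    fm : (A ⊗₀ V) ⊗₀ U ⇒ Y ⊗₀ U
    fm = f ∘ ((m ⊗₁ id) ∘ swapʳ)
    K : ((A ⊗₀ W) ⊗₀ V) ⊗₀ U ⇒ ((A ⊗₀ U) ⊗₀ V) ⊗₀ W → ((A ⊗₀ W) ⊗₀ V) ⊗₀ U ⇒ (Z ⊗₀ V) ⊗₀ U
    K t = (g ⊗₁ id) ∘ (swapʳ ∘ ((f ⊗₁ id) ∘ (((m ⊗₁ id) ⊗₁ id) ∘ t)))
    TailL TailR : ((A ⊗₀ W) ⊗₀ V) ⊗₀ U ⇒ ((A ⊗₀ U) ⊗₀ V) ⊗₀ W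
    TailL = swapʳ {A ⊗₀ U} {W} {V} ∘ ((swapʳ {A} {W} {U} ⊗₁ id {V}) ∘ swapʳ {A ⊗₀ W} {V} {U})
    TailR = (swapʳ {A} {V} {U} ⊗₁ id {W}) ∘ (swapʳ {A ⊗₀ V} {W} {U} ∘ (swapʳ {A} {W} {V} ⊗₁ id {U}))
    eqL : swapʳ ∘ ((P ∘ (((m ⊗₁ id) ∘ swapʳ) ⊗₁ id)) ∘ swapʳ) ≈ K TailL
    eqL = begin
      swapʳ ∘ ((P ∘ (((m ⊗₁ id) ∘ swapʳ) ⊗₁ id)) ∘ swapʳ) ≈⟨ refl⟩∘⟨ assoc ⟩
      swapʳ ∘ (P ∘ ((((m ⊗₁ id) ∘ swapʳ) ⊗₁ id) ∘ swapʳ)) ≈⟨ refl⟩∘⟨ assoc ⟩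
      swapʳ ∘ (swapʳ ∘ (((g ⊗₁ id) ∘ (swapʳ ∘ ((f ⊗₁ id) ∘ swapʳ))) ∘ ((((m ⊗₁ id) ∘ swapʳ) ⊗₁ id) ∘ swapʳ))) ≈⟨ cancelˡ swapʳ-involutive ⟩
      ((g ⊗₁ id) ∘ (swapʳ ∘ ((f ⊗₁ id) ∘ swapʳ))) ∘ ((((m ⊗₁ id) ∘ swapʳ) ⊗₁ id) ∘ swapʳ) ≈⟨ ≈trans assoc (refl⟩∘⟨ ≈trans assoc (refl⟩∘⟨ assoc)) ⟩
      (g ⊗₁ id) ∘ (swapʳ ∘ ((f ⊗₁ id) ∘ (swapʳ ∘ ((((m ⊗₁ id) ∘ swapʳ) ⊗₁ id) ∘ swapʳ)))) ≈⟨ refl⟩∘⟨ refl⟩∘⟨ refl⟩∘⟨ refl⟩∘⟨ (∘⊗id ⟩∘⟨refl) ⟩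
      (g ⊗₁ id) ∘ (swapʳ ∘ ((f ⊗₁ id) ∘ (swapʳ ∘ ((((m ⊗₁ id) ⊗₁ id) ∘ (swapʳ ⊗₁ id)) ∘ swapʳ)))) ≈⟨ refl⟩∘⟨ refl⟩∘⟨ refl⟩∘⟨ refl⟩∘⟨ assoc ⟩
      (g ⊗₁ id) ∘ (swapʳ ∘ ((f ⊗₁ id) ∘ (swapʳ ∘ (((m ⊗₁ id) ⊗₁ id) ∘ ((swapʳ ⊗₁ id) ∘ swapʳ))))) ≈⟨ refl⟩∘⟨ refl⟩∘⟨ refl⟩∘⟨ pullˡ swapʳ-natural ⟩
      (g ⊗₁ id) ∘ (swapʳ ∘ ((f ⊗₁ id) ∘ ((((m ⊗₁ id) ⊗₁ id) ∘ swapʳ) ∘ ((swapʳ ⊗₁ id) ∘ swapʳ)))) ≈⟨ refl⟩∘⟨ refl⟩∘⟨ refl⟩∘⟨ assoc ⟩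
      K TailL ∎
    eqR : K TailR ≈ (g ⊗₁ id) ∘ ((swapʳ {Y} {U} {W} ∘ ((fm ⊗₁ id) ∘ swapʳ {A ⊗₀ V} {W} {U})) ∘ (swapʳ {A} {W} {V} ⊗₁ id))
    eqR = ≈sym (begin
      (g ⊗₁ id) ∘ ((swapʳ ∘ ((fm ⊗₁ id) ∘ swapʳ)) ∘ (swapʳ ⊗₁ id)) ≈⟨ refl⟩∘⟨ ≈trans assoc (refl⟩∘⟨ assoc) ⟩
      (g ⊗₁ id) ∘ (swapʳ ∘ ((fm ⊗₁ id) ∘ (swapʳ ∘ (swapʳ ⊗₁ id)))) ≈⟨ refl⟩∘⟨ refl⟩∘⟨ (≈trans ∘⊗id (refl⟩∘⟨ ∘⊗id) ⟩∘⟨refl) ⟩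
      (g ⊗₁ id) ∘ (swapʳ ∘ (((f ⊗₁ id) ∘ (((m ⊗₁ id) ⊗₁ id) ∘ (swapʳ ⊗₁ id))) ∘ (swapʳ ∘ (swapʳ ⊗₁ id)))) ≈⟨ refl⟩∘⟨ refl⟩∘⟨ ≈trans assoc (refl⟩∘⟨ assoc) ⟩
      K TailR ∎)

  ρ⇒∘IntCompose : ∀ {A Y V Z W} (g : Y ⊗₀ W ⇒ Z ⊗₀ V) (k : A ⊗₀ V ⇒ Y ⊗₀ unit) →
                  ρ⇒ ∘ IntCompose {A , unit} {Y , V} {Z , W} g k ≈ act g (ρ⇒ ∘ k)
  ρ⇒∘IntCompose g k = begin
    ρ⇒ ∘ IntCompose g k ≈⟨ refl⟩∘⟨ IntCompose-swapʳ g k ⟩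
    ρ⇒ ∘ Tr (swapʳ ∘ ((g ⊗₁ id) ∘ (swapʳ ∘ ((k ⊗₁ id) ∘ swapʳ)))) ≈⟨ tighteningˡ ⟩
    Tr ((ρ⇒ ⊗₁ id) ∘ (swapʳ ∘ ((g ⊗₁ id) ∘ (swapʳ ∘ ((k ⊗₁ id) ∘ swapʳ))))) ≈⟨ Tr-resp-≈ unitors ⟩
    Tr (g ∘ (((ρ⇒ ∘ k) ⊗₁ id) ∘ swapʳ)) ∎
    where
    unitors : (ρ⇒ ⊗₁ id) ∘ (swapʳ ∘ ((g ⊗₁ id) ∘ (swapʳ ∘ ((k ⊗₁ id) ∘ swapʳ)))) ≈ g ∘ (((ρ⇒ ∘ k) ⊗₁ id) ∘ swapʳ)
    unitors = begin
      (ρ⇒ ⊗₁ id) ∘ (swapʳ ∘ ((g ⊗₁ id) ∘ (swapʳ ∘ ((k ⊗₁ id) ∘ swapʳ)))) ≈⟨ refl⟩∘⟨ (swapʳ-unit₃ ⟩∘⟨refl) ⟩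
      (ρ⇒ ⊗₁ id) ∘ (((ρ⇐ ⊗₁ id) ∘ ρ⇒) ∘ ((g ⊗₁ id) ∘ (swapʳ ∘ ((k ⊗₁ id) ∘ swapʳ)))) ≈⟨ refl⟩∘⟨ assoc ⟩
      (ρ⇒ ⊗₁ id) ∘ ((ρ⇐ ⊗₁ id) ∘ (ρ⇒ ∘ ((g ⊗₁ id) ∘ (swapʳ ∘ ((k ⊗₁ id) ∘ swapʳ))))) ≈⟨ cancelˡ (⊗id-iso ρ-isoʳ) ⟩
      ρ⇒ ∘ ((g ⊗₁ id) ∘ (swapʳ ∘ ((k ⊗₁ id) ∘ swapʳ))) ≈⟨ pullˡ ρ-natural ⟩
      (g ∘ ρ⇒) ∘ (swapʳ ∘ ((k ⊗₁ id) ∘ swapʳ)) ≈⟨ assoc ⟩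
      g ∘ (ρ⇒ ∘ (swapʳ ∘ ((k ⊗₁ id) ∘ swapʳ))) ≈⟨ refl⟩∘⟨ refl⟩∘⟨ (swapʳ-unit₂ ⟩∘⟨refl) ⟩
      g ∘ (ρ⇒ ∘ ((ρ⇐ ∘ (ρ⇒ ⊗₁ id)) ∘ ((k ⊗₁ id) ∘ swapʳ))) ≈⟨ refl⟩∘⟨ refl⟩∘⟨ assoc ⟩
      g ∘ (ρ⇒ ∘ (ρ⇐ ∘ ((ρ⇒ ⊗₁ id) ∘ ((k ⊗₁ id) ∘ swapʳ)))) ≈⟨ refl⟩∘⟨ cancelˡ ρ-isoʳ ⟩
      g ∘ ((ρ⇒ ⊗₁ id) ∘ ((k ⊗₁ id) ∘ swapʳ)) ≈⟨ refl⟩∘⟨ pullˡ (≈sym ∘⊗id) ⟩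
      g ∘ (((ρ⇒ ∘ k) ⊗₁ id) ∘ swapʳ) ∎

  act-ρ⇒ : ∀ {Y Z W} {x : Y ⊗₀ W ⇒ Z ⊗₀ unit} → act x ρ⇒ ≈ ρ⇒ ∘ x
  act-ρ⇒ {x = x} = begin
    Tr (x ∘ ((ρ⇒ ⊗₁ id) ∘ swapʳ)) ≈⟨ vanishing₁ ⟩
    ρ⇒ ∘ ((x ∘ ((ρ⇒ ⊗₁ id) ∘ swapʳ)) ∘ ρ⇐) ≈⟨ refl⟩∘⟨ ((refl⟩∘⟨ refl⟩∘⟨ swapʳ-unit₃) ⟩∘⟨refl) ⟩
    ρ⇒ ∘ ((x ∘ ((ρ⇒ ⊗₁ id) ∘ ((ρ⇐ ⊗₁ id) ∘ ρ⇒))) ∘ ρ⇐) ≈⟨ refl⟩∘⟨ ((refl⟩∘⟨ cancelˡ (⊗id-iso ρ-isoʳ)) ⟩∘⟨refl) ⟩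
    ρ⇒ ∘ ((x ∘ ρ⇒) ∘ ρ⇐) ≈⟨ refl⟩∘⟨ cancelʳ ρ-isoʳ ⟩
    ρ⇒ ∘ x ∎

  ρ⇒∘IntCompose-N : ∀ {A Y Z W} (x : Y ⊗₀ W ⇒ Z ⊗₀ unit) (h : A ⇒ Y) →
                    ρ⇒ ∘ IntCompose {A , unit} {Y , unit} {Z , W} x (N.F₁ h) ≈ (ρ⇒ ∘ x) ∘ (h ⊗₁ id)
  ρ⇒∘IntCompose-N x h = begin
    ρ⇒ ∘ IntCompose x (N.F₁ h) ≈⟨ ρ⇒∘IntCompose x (N.F₁ h) ⟩
    act x (ρ⇒ ∘ (ρ⇐ ∘ (h ∘ ρ⇒))) ≈⟨ act-resp-≈ ≈refl (≈trans (cancelˡ ρ-isoʳ) (≈sym ρ-natural)) ⟩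
    act x (ρ⇒ ∘ (h ⊗₁ id)) ≈⟨ act-natural ⟩
    act x ρ⇒ ∘ (h ⊗₁ id) ≈⟨ act-ρ⇒ ⟩∘⟨refl ⟩
    (ρ⇒ ∘ x) ∘ (h ⊗₁ id) ∎

  ρ⇒∘IntCompose-natural :
    ∀ {A B Y Z V W} (g : Y ⊗₀ W ⇒ Z ⊗₀ V) (k : B ⊗₀ V ⇒ Y ⊗₀ unit) (h : A ⇒ B) →
    ρ⇒ ∘ IntCompose {A , unit} {Y , V} {Z , W} g (IntCompose {A , unit} {B , unit} {Y , V} k (N.F₁ h))
    ≈ act g (ρ⇒ ∘ k) ∘ (h ⊗₁ id)
  ρ⇒∘IntCompose-natural g k h = begin
    ρ⇒ ∘ IntCompose g (IntCompose k (N.F₁ h)) ≈⟨ ρ⇒∘IntCompose g _ ⟩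
    act g (ρ⇒ ∘ IntCompose k (N.F₁ h)) ≈⟨ act-resp-≈ ≈refl (ρ⇒∘IntCompose-N k h) ⟩
    act g ((ρ⇒ ∘ k) ∘ (h ⊗₁ id)) ≈⟨ act-natural ⟩
    act g (ρ⇒ ∘ k) ∘ (h ⊗₁ id) ∎

record NaturalTransposition {o ℓ e o′ ℓ′ e′} {𝒞 : Category o ℓ e} {𝒟 : Category o′ ℓ′ e′}
       (L : RawFunctor (Category.raw 𝒞) (Category.raw 𝒟)) : Set (o ⊔ ℓ ⊔ e ⊔ o′ ⊔ ℓ′ ⊔ e′) where
  private
    module C = HomReasoning 𝒞
    module D = HomReasoning 𝒟
    module L = RawFunctor L
  field
    R₀        : D.Obj → C.Obj
    φ         : ∀ {a b} → L.F₀ a D.⇒ b → a C.⇒ R₀ b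
    ψ         : ∀ {a b} → a C.⇒ R₀ b → L.F₀ a D.⇒ b
    φ-resp    : ∀ {a b} {k k′ : L.F₀ a D.⇒ b} → k D.≈ k′ → φ k C.≈ φ k′
    ψ-resp    : ∀ {a b} {h h′ : a C.⇒ R₀ b} → h C.≈ h′ → ψ h D.≈ ψ h′
    φψ        : ∀ {a b} (h : a C.⇒ R₀ b) → φ (ψ h) C.≈ h
    ψφ        : ∀ {a b} (k : L.F₀ a D.⇒ b) → ψ (φ k) D.≈ k
    φ-natural : ∀ {a a′ b} (f : a′ C.⇒ a) (k : L.F₀ a D.⇒ b) → φ (k D.∘ L.F₁ f) C.≈ φ k C.∘ f

  counit : ∀ {b} → L.F₀ (R₀ b) D.⇒ b
  counit = ψ C.id

  ψ-natural : ∀ {a a′ b} (h : a C.⇒ R₀ b) (f : a′ C.⇒ a) → ψ (h C.∘ f) D.≈ ψ h D.∘ L.F₁ f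
  ψ-natural h f = D.≈trans (ψ-resp (C.≈sym (φψ h) C.⟩∘⟨refl))
                   (D.≈trans (ψ-resp (C.≈sym (φ-natural f (ψ h)))) (ψφ _))

  counit-φ : ∀ {a b} (k : L.F₀ a D.⇒ b) → counit D.∘ L.F₁ (φ k) D.≈ k
  counit-φ k = D.≈trans (D.≈sym (ψ-natural C.id (φ k))) (D.≈trans (ψ-resp C.identityˡ) (ψφ k))

  R₁ : ∀ {b b′} → b D.⇒ b′ → R₀ b C.⇒ R₀ b′
  R₁ g = φ (g D.∘ counit)

  φ-natural₂ : ∀ {a a′ b b′} (f : a′ C.⇒ a) (k : L.F₀ a D.⇒ b) (g : b D.⇒ b′) →
               φ (g D.∘ (k D.∘ L.F₁ f)) C.≈ R₁ g C.∘ (φ k C.∘ f)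
  φ-natural₂ f k g = C.≈sym (C.begin
    φ (g D.∘ counit) C.∘ (φ k C.∘ f) C.≈⟨ C.refl⟩∘⟨ C.≈sym (φ-natural f k) ⟩
    φ (g D.∘ counit) C.∘ φ (k D.∘ L.F₁ f) C.≈⟨ C.≈sym (φ-natural _ _) ⟩
    φ ((g D.∘ counit) D.∘ L.F₁ (φ (k D.∘ L.F₁ f))) C.≈⟨ φ-resp (D.pullʳ (counit-φ _)) ⟩
    φ (g D.∘ (k D.∘ L.F₁ f)) C.∎)

  rightAdjoint : RightAdjoint L
  rightAdjoint = record
    { R              = record { F₀ = R₀ ; F₁ = R₁ }
    ; R-identity     = C.≈trans (φ-resp D.identityˡ) (φψ C.id)
    ; R-homomorphism = λ {_} {_} {_} {f} {g} → R-homomorphism f g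
    ; R-resp-≈       = λ p → φ-resp (p D.⟩∘⟨refl)
    ; φ              = φ
    ; ψ              = ψ
    ; φ-resp         = φ-resp
    ; ψ-resp         = ψ-resp
    ; φψ             = φψ
    ; ψφ             = ψφ
    ; natural        = φ-natural₂
    }
    where
    R-homomorphism : ∀ {b b′ b″} (f : b D.⇒ b′) (g : b′ D.⇒ b″) → R₁ (g D.∘ f) C.≈ R₁ g C.∘ R₁ f
    R-homomorphism f g = C.≈sym (C.≈trans (C.≈sym (φ-natural _ _))
                          (φ-resp (D.≈trans (D.pullʳ (counit-φ _)) D.sym-assoc)))

fromRightAdjoint : ∀ {o ℓ e o′ ℓ′ e′} {𝒞 : Category o ℓ e} {𝒟 : Category o′ ℓ′ e′}
                   {L : RawFunctor (Category.raw 𝒞) (Category.raw 𝒟)} →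
                   RightAdjoint L → NaturalTransposition {𝒞 = 𝒞} {𝒟} L
fromRightAdjoint {𝒞 = 𝒞} {𝒟} A = record
  { R₀        = R.F₀
  ; φ         = φ
  ; ψ         = ψ
  ; φ-resp    = φ-resp
  ; ψ-resp    = ψ-resp
  ; φψ        = φψ
  ; ψφ        = ψφ
  ; φ-natural = λ f k → C.≈trans (φ-resp (D.≈sym D.identityˡ))
                          (C.≈trans (natural f k D.id) (C.≈trans (R-identity C.⟩∘⟨refl) C.identityˡ))
  }
  where
  module C = HomReasoning 𝒞
  module D = HomReasoning 𝒟
  open RightAdjoint A

module _ {o₁ ℓ₁ e₁ o₂ ℓ₂ e₂} {𝒞 : Category o₁ ℓ₁ e₁} {𝒟 : Category o₂ ℓ₂ e₂}
         (S : SymmetricMonoidal 𝒟) (T : Trace 𝒟 S) (F : Functor 𝒞 𝒟) where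
  open IntProperties T
  open IntConstruction 𝒟 S T using (IntCompose; IntHom; IntObj)
  private
    module C = HomReasoning 𝒞
    module F = Functor F

  restrict : HasRightAdjoint (N∘F S T F) → (d : Obj) → NaturalTransposition {𝒞 = 𝒞} {𝒟} (F-⊗_ S T F d)
  restrict A d = record
    { R₀        = λ b → R.F₀ (b , d)
    ; φ         = λ k → φ (ρ⇐ ∘ k)
    ; ψ         = λ h → ρ⇒ ∘ ψ h
    ; φ-resp    = λ p → φ-resp (refl⟩∘⟨ p)
    ; ψ-resp    = λ p → refl⟩∘⟨ ψ-resp p
    ; φψ        = λ h → C.≈trans (φ-resp (cancelˡ ρ-isoˡ)) (φψ h)
    ; ψφ        = λ k → ≈trans (refl⟩∘⟨ ψφ _) (cancelˡ ρ-isoʳ)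
    ; φ-natural = φ-natural
    }
    where
    open RightAdjoint A
    φ-natural : ∀ {a a′ b} (f : a′ C.⇒ a) (k : F.F₀ a ⊗₀ d ⇒ b) →
                φ (ρ⇐ ∘ (k ∘ (F.F₁ f ⊗₁ id))) C.≈ φ (ρ⇐ ∘ k) C.∘ f
    φ-natural f k = C.begin
      φ (ρ⇐ ∘ (k ∘ (F.F₁ f ⊗₁ id))) C.≈⟨ φ-resp (≈sym (switch-fromˡ ρ-isoˡ ρ⇒∘composite)) ⟩
      φ (IntCompose id (IntCompose (ρ⇐ ∘ k) (RawFunctor.F₁ (N∘F S T F) f))) C.≈⟨ natural f (ρ⇐ ∘ k) id ⟩
      R.F₁ id C.∘ (φ (ρ⇐ ∘ k) C.∘ f) C.≈⟨ R-identity C.⟩∘⟨refl ⟩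
      C.id C.∘ (φ (ρ⇐ ∘ k) C.∘ f) C.≈⟨ C.identityˡ ⟩
      φ (ρ⇐ ∘ k) C.∘ f C.∎
      where
      ρ⇒∘composite : ρ⇒ ∘ IntCompose id (IntCompose (ρ⇐ ∘ k) (RawFunctor.F₁ (N∘F S T F) f))
                     ≈ k ∘ (F.F₁ f ⊗₁ id)
      ρ⇒∘composite = begin
        ρ⇒ ∘ IntCompose id (IntCompose (ρ⇐ ∘ k) (RawFunctor.F₁ (N∘F S T F) f)) ≈⟨ ρ⇒∘IntCompose-natural id (ρ⇐ ∘ k) (F.F₁ f) ⟩
        act id (ρ⇒ ∘ (ρ⇐ ∘ k)) ∘ (F.F₁ f ⊗₁ id) ≈⟨ ≈trans act-identity (cancelˡ ρ-isoʳ) ⟩∘⟨refl ⟩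
        k ∘ (F.F₁ f ⊗₁ id) ∎

  module Extend (H : (d : Obj) → NaturalTransposition {𝒞 = 𝒞} {𝒟} (F-⊗_ S T F d)) where
    private
      module H (d : Obj) = NaturalTransposition (H d)

    R₀ : IntObj → C.Obj
    R₀ (b , d) = H.R₀ d b

    R₁ : ∀ {x y} → IntHom x y → R₀ x C.⇒ R₀ y
    R₁ {b , d} {b′ , d′} g = H.φ d′ (act g (H.counit d))

    φ-act : ∀ {a b d b′ d′} (g : IntHom (b , d) (b′ , d′)) (m : F.F₀ a ⊗₀ d ⇒ b) →
            H.φ d′ (act g m) C.≈ R₁ g C.∘ H.φ d m
    φ-act {d = d} {d′ = d′} g m = C.begin
      H.φ d′ (act g m) C.≈⟨ H.φ-resp d′ (act-resp-≈ ≈refl (≈sym (H.counit-φ d m))) ⟩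
      H.φ d′ (act g (H.counit d ∘ (F.F₁ (H.φ d m) ⊗₁ id))) C.≈⟨ H.φ-resp d′ act-natural ⟩
      H.φ d′ (act g (H.counit d) ∘ (F.F₁ (H.φ d m) ⊗₁ id)) C.≈⟨ H.φ-natural d′ _ _ ⟩
      H.φ d′ (act g (H.counit d)) C.∘ H.φ d m C.∎

    R-identity : ∀ {x} → R₁ {x} {x} id C.≈ C.id
    R-identity {b , d} = C.≈trans (H.φ-resp d act-identity) (H.φψ d C.id)

    R-resp-≈ : ∀ {x y} {f g : IntHom x y} → f ≈ g → R₁ f C.≈ R₁ g
    R-resp-≈ {b , d} {b′ , d′} p = H.φ-resp d′ (act-resp-≈ p ≈refl)

    R-homomorphism : ∀ {x y z} {f : IntHom x y} {g : IntHom y z} →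
                     R₁ (IntCompose {x} {y} {z} g f) C.≈ R₁ g C.∘ R₁ f
    R-homomorphism {b , d} {b′ , d′} {b″ , d″} {f} {g} =
      C.≈trans (H.φ-resp d″ (act-homomorphism g f (H.counit d))) (φ-act g (act f (H.counit d)))

    φ : ∀ {a x} → IntHom (F.F₀ a , unit) x → a C.⇒ R₀ x
    φ {a} {b , d} k = H.φ d (ρ⇒ ∘ k)

    ψ : ∀ {a x} → a C.⇒ R₀ x → IntHom (F.F₀ a , unit) x
    ψ {a} {b , d} h = ρ⇐ ∘ H.ψ d h

    natural : ∀ {a a′ x y} (f : a′ C.⇒ a) (k : IntHom (F.F₀ a , unit) x) (g : IntHom x y) →
              φ {a′} {y} (IntCompose {F.F₀ a′ , unit} {x} {y} g
                           (IntCompose {F.F₀ a′ , unit} {F.F₀ a , unit} {x} k (RawFunctor.F₁ (N∘F S T F) f)))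
              C.≈ R₁ g C.∘ (φ k C.∘ f)
    natural {a} {a′} {b , d} {b′ , d′} f k g = C.begin
      H.φ d′ (ρ⇒ ∘ IntCompose g (IntCompose k (RawFunctor.F₁ (N∘F S T F) f))) C.≈⟨ H.φ-resp d′ (ρ⇒∘IntCompose-natural g k (F.F₁ f)) ⟩
      H.φ d′ (act g (ρ⇒ ∘ k) ∘ (F.F₁ f ⊗₁ id)) C.≈⟨ H.φ-natural d′ f _ ⟩
      H.φ d′ (act g (ρ⇒ ∘ k)) C.∘ f C.≈⟨ φ-act g (ρ⇒ ∘ k) C.⟩∘⟨refl ⟩
      (R₁ g C.∘ H.φ d (ρ⇒ ∘ k)) C.∘ f C.≈⟨ C.assoc ⟩
      R₁ g C.∘ (H.φ d (ρ⇒ ∘ k) C.∘ f) C.∎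

    rightAdjoint : HasRightAdjoint (N∘F S T F)
    rightAdjoint = record
      { R              = record { F₀ = R₀ ; F₁ = R₁ }
      ; R-identity     = λ {x} → R-identity {x}
      ; R-homomorphism = λ {x} {y} {z} → R-homomorphism {x} {y} {z}
      ; R-resp-≈       = λ {x} {y} → R-resp-≈ {x} {y}
      ; φ              = λ {a} {x} → φ {a} {x}
      ; ψ              = λ {a} {x} → ψ {a} {x}
      ; φ-resp         = λ {a} {x} → φ-resp {a} {x}
      ; ψ-resp         = λ {a} {x} → ψ-resp {a} {x}
      ; φψ             = λ {a} {x} → φψ {a} {x}
      ; ψφ             = λ {a} {x} → ψφ {a} {x}
      ; natural        = λ {a} {a′} {x} {y} → natural {a} {a′} {x} {y}
      }
      where
      φ-resp : ∀ {a x} {k k′ : IntHom (F.F₀ a , unit) x} → k ≈ k′ → φ {a} {x} k C.≈ φ k′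
      φ-resp {a} {b , d} p = H.φ-resp d (refl⟩∘⟨ p)
      ψ-resp : ∀ {a x} {h h′ : a C.⇒ R₀ x} → h C.≈ h′ → ψ {a} {x} h ≈ ψ h′
      ψ-resp {a} {b , d} p = refl⟩∘⟨ H.ψ-resp d p
      φψ : ∀ {a x} (h : a C.⇒ R₀ x) → φ {a} {x} (ψ h) C.≈ h
      φψ {a} {b , d} h = C.≈trans (H.φ-resp d (cancelˡ ρ-isoʳ)) (H.φψ d h)
      ψφ : ∀ {a x} (k : IntHom (F.F₀ a , unit) x) → ψ {a} {x} (φ k) ≈ k
      ψφ {a} {b , d} k = ≈trans (refl⟩∘⟨ H.ψφ d _) (cancelˡ ρ-isoˡ)

theorem1 : ∀ {o₁ ℓ₁ e₁ o₂ ℓ₂ e₂} (C : Category o₁ ℓ₁ e₁) (D : Category o₂ ℓ₂ e₂)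
    (S : SymmetricMonoidal D) (T : Trace D S) (F : Functor C D) →
    HasRightAdjoint (N∘F S T F)
    ⇔ ((d : Category.Obj D) → HasRightAdjoint (F-⊗_ S T F d))
theorem1 C D S T F = mk⇔
  (λ A d → NaturalTransposition.rightAdjoint (restrict S T F A d))
  (λ H → Extend.rightAdjoint S T F (λ d → fromRightAdjoint (H d)))
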